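{- For every integer $t\ge 3$, as $n\to\infty$, $ex_3(n,\mathbb{H}_t^3S_2)=(t+o(1))\frac{n^2}{6}$.
   Context: $S_2$ denotes the star with two edges (the path with three vertices). A $3$-uniform hypergraph consists of a finite vertex set and a set of distinct $3$-element subsets (hyperedges). For an integer $t\ge1$ and a graph $F$, a hypergraph $\mathcal{F}$ is a $t$-heavy copy of $F$ if there exist an injection $i:V(F)\to V(\mathcal{F})$ and a map $h$ assigning to each edge $e$ of $F$ a set $h(e)$ of $t$ distinct hyperedges of $\mathcal{F}$ such that for every edge $e=xy$ of $F$, $\{i(x),i(y)\}\subseteq A$ for all $A\in h(e)$. $\mathbb{H}_t^3F$ is the family of $3$-uniform $t$-heavy copies of $F$. $ex_3(n,\mathbb{F})$ is the maximum number of hyperedges in a $3$-uniform hypergraph on $n$ vertices containing no member of $\mathbb{F}$ as a subhypergraph. -}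

module Defs where

open import Data.Nat using (ℕ; zero; suc; _+_; _*_; _∸_; _≤_)
open import Data.Fin using (Fin; _<_)
open import Data.Product using (Σ; _×_; _,_; ∃; ∃-syntax)
open import Data.Sum using (_⊎_)
open import Data.List using (List; length)
open import Data.List.Relation.Unary.All using (All)
open import Data.List.Relation.Unary.Unique.Propositional using (Unique)
open import Data.List.Membership.Propositional using (_∈_)
open import Relation.Binary.PropositionalEquality using (_≡_)
open import Function.Definitions using (Injective)

-- A 3-element subset {a,b,c} of Fin n, represented canonically as a < b < c.
record Triple (n : ℕ) : Set where
  constructor triple
  field
    a b c : Fin n
    a<b   : a < b
    b<c   : b < c

open Triple public

_∈ᵥ_ : ∀ {n} → Fin n → Triple n → Set
v ∈ᵥ e = v ≡ a e ⊎ v ≡ b e ⊎ v ≡ c e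

record Hypergraph (n : ℕ) : Set where
  constructor hypergraph
  field
    edges    : List (Triple n)
    distinct : Unique edges

open Hypergraph public

∣_∣ₑ : ∀ {n} → Hypergraph n → ℕ
∣ H ∣ₑ = length (edges H)

record Graph : Set where
  constructor graph
  field
    order  : ℕ
    gedges : List (Fin order × Fin order)

open Graph public

S₂ : Graph
S₂ = graph 3 ((Fin.zero , Fin.suc Fin.zero) Data.List.∷ (Fin.zero , Fin.suc (Fin.suc Fin.zero)) Data.List.∷ Data.List.[])
  where import Data.Fin as Fin

HeavyEdge : ∀ {n f} → ℕ → Hypergraph n → (Fin f → Fin n) → Fin f × Fin f → Set
HeavyEdge {n} t H i (x , y) =
  Σ (List (Triple n)) λ L →
    length L ≡ t × Unique L × All (_∈ edges H) L ×
    All (λ A → i x ∈ᵥ A × i y ∈ᵥ A) L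

-- H contains (as a subhypergraph) a t-heavy copy of F, i.e. a member of 𝕳ᵗ F:
-- an injection i : V(F) → V(H) and for every edge e of F a set h(e) of t
-- distinct hyperedges of H containing the images of the ends of e.
ContainsHeavy : ∀ {n} → ℕ → Graph → Hypergraph n → Set
ContainsHeavy {n} t F H =
  Σ (Fin (order F) → Fin n) λ i → Injective _≡_ _≡_ i × All (HeavyEdge t H i) (gedges F)

-- m = ex₃(n, 𝕳ᵗ F): some F-free hypergraph on n vertices has m hyperedges
-- and every 𝕳ᵗ F-free hypergraph on n vertices has at most m hyperedges.
IsEx₃ : ℕ → ℕ → Graph → ℕ → Set
IsEx₃ n t F m =
  (Σ (Hypergraph n) λ H → (ContainsHeavy t F H → Data.Empty.⊥) × ∣ H ∣ₑ ≡ m) ×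
  ((H : Hypergraph n) → (ContainsHeavy t F H → Data.Empty.⊥) → ∣ H ∣ₑ ≤ m)
  where import Data.Empty

-- Write codeg(u, v) for the number of hyperedges through two distinct vertices u, v.  A t-heavy
-- S₂ is exactly a vertex u with two distinct neighbours v, w of codegree at least t, and
-- Σ_u Σ_v codeg(u, v) = 6|E|.
-- Upper bound: without a heavy S₂ every u has at most one heavy neighbour, whose codegree is at
-- most n, so each row sum is at most (t − 1)n + n and 6|E| ≤ t n².
-- Lower bound, with T = t − 3: on ℤ_N, N = 2⌊n/2⌋, pair x with x + N/2 and take every triple
-- containing a pair, together with every triple of distinct vertices whose sum lies in
-- {0, …, T − 1}.  Two unpaired vertices have codegree at most 2 + T (their two partners and one
-- third vertex per admissible sum), so only partners are heavy and there is no heavy S₂.  On the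
-- other hand u has about N common hyperedges with its partner and 2 + T with almost every other
-- vertex: for each sum, at most 8 choices of v put the third vertex in the pair of u or of v.
-- Hence 6|E| ≥ t n² − 11 t n.

module Submission where

open import Defs
open import Data.Nat using (ℕ; suc; _*_; _∸_; _≤_; _^_)
open import Data.Product using (Σ; _×_)

open import Algebra.Properties.CommutativeSemigroup using (interchange)
open import Data.Bool using (if_then_else_)
open import Data.Empty using (⊥-elim)
open import Data.Fin using (Fin; toℕ; fromℕ<) renaming (_≟_ to _≟ᶠ_; _<?_ to _<?ᶠ_)
import Data.Fin as Fin
open import Data.Fin.Properties using (toℕ-injective; toℕ<n; toℕ-fromℕ<)
open import Data.List using (List; []; _∷_; length; filter; take; concatMap; allFin; deduplicate; applyUpTo)
open import Data.List.Membership.DecPropositional Data.Nat._≟_ using (_∈?_)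
open import Data.List.Membership.Propositional using (_∈_)
open import Data.List.Membership.Propositional.Properties
  using (∈-filter⁺; ∈-filter⁻; ∈-applyUpTo⁺; ∈-concatMap⁺; ∈-allFin; ∈-deduplicate⁺; ∈-deduplicate⁻)
open import Data.List.Properties
  using (length-take; length-applyUpTo; filter-notAll; filter-reject; filter-all; filter-accept)
open import Data.List.Relation.Unary.All using (All; []; _∷_)
import Data.List.Relation.Unary.All as All
import Data.List.Relation.Unary.All.Properties as All
open import Data.List.Relation.Unary.Any using (here; there)
import Data.List.Relation.Unary.Any as Any
open import Data.List.Relation.Unary.Unique.Propositional using (Unique; []; _∷_)
import Data.List.Relation.Unary.Unique.Propositional.Properties as Unique
open import Data.Nat using (zero; _+_; _<_; z≤n; s≤s; _≟_; _<?_; _≤?_; NonZero; _/_; _%_)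
open import Data.Nat.Divisibility using (divides)
open import Data.Nat.DivMod
open import Data.Nat.Properties
open import Data.Nat.Tactic.RingSolver using (solve-∀)
open import Data.Product using (_,_; proj₁; proj₂; ∃-syntax)
open import Data.Sum using (_⊎_; inj₁; inj₂)
open import Function using (_∘_; flip; _⟨_⟩_)
open import Level using (Level)
open import Relation.Binary.Definitions using (DecidableEquality; tri<; tri≈; tri>)
open import Relation.Binary.PropositionalEquality hiding ([_])
open import Relation.Nullary using (Dec; yes; no; does; ¬_; ¬?)
open import Relation.Nullary.Decidable using (_×-dec_; _⊎-dec_)

private
  variable
    p : Level
    P : Set p
    A : Set p

-- Indicators and finite sums

𝟙 : Dec P → ℕ
𝟙 d = if does d then 1 else 0

𝟙-yes : (d : Dec P) → P → 𝟙 d ≡ 1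
𝟙-yes (yes _) _  = refl
𝟙-yes (no ¬p) p = ⊥-elim (¬p p)

𝟙-no : (d : Dec P) → ¬ P → 𝟙 d ≡ 0
𝟙-no (yes p) ¬p = ⊥-elim (¬p p)
𝟙-no (no _)  _  = refl

𝟙≤1 : (d : Dec P) → 𝟙 d ≤ 1
𝟙≤1 (yes _) = s≤s z≤n
𝟙≤1 (no _)  = z≤n

𝟙-witness : (d : Dec P) → 0 < 𝟙 d → P
𝟙-witness (yes p) _ = p

≤𝟙 : ∀ {x} (d : Dec P) → x ≤ 1 → (0 < x → P) → x ≤ 𝟙 d
≤𝟙 (yes _) x≤1 _ = x≤1
≤𝟙 {x = zero}  (no _)  _ _ = z≤n
≤𝟙 {x = suc _} (no ¬p) _ h = ⊥-elim (¬p (h (s≤s z≤n)))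

∑ : ℕ → (ℕ → ℕ) → ℕ
∑ zero    f = 0
∑ (suc n) f = ∑ n f + f n

syntax ∑ n (λ i → e) = ∑[ i < n ] e

∑-cong : ∀ n {f g} → (∀ i → i < n → f i ≡ g i) → ∑ n f ≡ ∑ n g
∑-cong zero    _ = refl
∑-cong (suc n) h = cong₂ _+_ (∑-cong n (λ i i<n → h i (m<n⇒m<1+n i<n))) (h n ≤-refl)

∑-mono-≤ : ∀ n {f g} → (∀ i → i < n → f i ≤ g i) → ∑ n f ≤ ∑ n g
∑-mono-≤ zero    _ = z≤n
∑-mono-≤ (suc n) h = +-mono-≤ (∑-mono-≤ n (λ i i<n → h i (m<n⇒m<1+n i<n))) (h n ≤-refl)

∑-monoˡ-≤ : ∀ f {m n} → m ≤ n → ∑ m f ≤ ∑ n f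
∑-monoˡ-≤ f {n = zero}  z≤n = z≤n
∑-monoˡ-≤ f {n = suc n} m≤1+n with m≤n⇒m<n∨m≡n m≤1+n
... | inj₂ refl    = ≤-refl
... | inj₁ m<1+n   = ≤-trans (∑-monoˡ-≤ f (≤-pred m<1+n)) (m≤m+n (∑ n f) (f n))

∑-distrib-+ : ∀ n f g → ∑[ i < n ] (f i + g i) ≡ ∑ n f + ∑ n g
∑-distrib-+ zero    f g = refl
∑-distrib-+ (suc n) f g = begin
  ∑[ i < n ] (f i + g i) + (f n + g n) ≡⟨ cong (_+ (f n + g n)) (∑-distrib-+ n f g) ⟩
  ∑ n f + ∑ n g + (f n + g n)          ≡⟨ interchange +-commutativeSemigroup (∑ n f) (∑ n g) (f n) (g n) ⟩
  ∑ n f + f n + (∑ n g + g n)          ∎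
  where open ≡-Reasoning

∑-const : ∀ n c → ∑[ _ < n ] c ≡ n * c
∑-const zero    c = refl
∑-const (suc n) c = trans (cong (_+ c) (∑-const n c)) (+-comm (n * c) c)

∑-distribˡ-* : ∀ n c f → ∑[ i < n ] (c * f i) ≡ c * ∑ n f
∑-distribˡ-* zero    c f = sym (*-zeroʳ c)
∑-distribˡ-* (suc n) c f =
  trans (cong (_+ c * f n) (∑-distribˡ-* n c f)) (sym (*-distribˡ-+ c (∑ n f) (f n)))

∑-comm : ∀ m n (f : ℕ → ℕ → ℕ) → ∑[ i < m ] ∑ n (f i) ≡ ∑[ j < n ] ∑[ i < m ] f i j
∑-comm zero    n f = sym (∑-const n 0 ⟨ trans ⟩ *-zeroʳ n)
∑-comm (suc m) n f =
  trans (cong (_+ ∑ n (f m)) (∑-comm m n f)) (sym (∑-distrib-+ n (λ j → ∑[ i < m ] f i j) (f m)))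

term≤∑ : ∀ n f {j} → j < n → f j ≤ ∑ n f
term≤∑ (suc n) f {j} j<1+n with j ≟ n
... | yes refl = m≤n+m (f n) (∑ n f)
... | no  j≢n  = ≤-trans (term≤∑ n f (≤∧≢⇒< (≤-pred j<1+n) j≢n)) (m≤m+n (∑ n f) (f n))

∑-cover : ∀ n f → (∀ i → i < n → 0 < f i) → n ≤ ∑ n f
∑-cover n f h = ≤-trans (≤-reflexive (sym (∑-const n 1 ⟨ trans ⟩ *-identityʳ n))) (∑-mono-≤ n h)

∑-pos : ∀ n f → 0 < ∑ n f → ∃[ i ] i < n × 0 < f i
∑-pos (suc n) f h with f n in eq
... | suc _ = n , ≤-refl , subst (0 <_) (sym eq) (s≤s z≤n)
... | zero  with ∑-pos n f (subst (0 <_) (+-identityʳ (∑ n f)) h)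
...   | i , i<n , fi>0 = i , m<n⇒m<1+n i<n , fi>0

∑-≤1 : ∀ n f → (∀ i → i < n → f i ≤ 1) →
       (∀ i j → i < n → j < n → 0 < f i → 0 < f j → i ≡ j) → ∑ n f ≤ 1
∑-≤1 zero    f _    _      = z≤n
∑-≤1 (suc n) f f≤1 unique with f n in eq
... | zero  = subst (_≤ 1) (sym (+-identityʳ (∑ n f)))
                (∑-≤1 n f (λ i i<n → f≤1 i (m<n⇒m<1+n i<n))
                          (λ i j i<n j<n → unique i j (m<n⇒m<1+n i<n) (m<n⇒m<1+n j<n)))
... | suc k = subst (λ x → x + suc k ≤ 1) (sym (∑-cong n vanish ⟨ trans ⟩ ∑-const n 0 ⟨ trans ⟩ *-zeroʳ n))
                (subst (_≤ 1) eq (f≤1 n ≤-refl))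
  where
  vanish : ∀ i → i < n → f i ≡ 0
  vanish i i<n with f i in eqi
  ... | zero  = refl
  ... | suc _ = ⊥-elim (<-irrefl (unique i n (m<n⇒m<1+n i<n) ≤-refl
                                    (subst (0 <_) (sym eqi) (s≤s z≤n)) (subst (0 <_) (sym eq) (s≤s z≤n))) i<n)

∑-𝟙≡-≤1 : ∀ n a → ∑[ i < n ] 𝟙 (i ≟ a) ≤ 1
∑-𝟙≡-≤1 n a = ∑-≤1 n _ (λ i _ → 𝟙≤1 (i ≟ a))
  (λ i j _ _ i>0 j>0 → trans (𝟙-witness (i ≟ a) i>0) (sym (𝟙-witness (j ≟ a) j>0)))

∑-𝟙≡ : ∀ n {a} → a < n → ∑[ i < n ] 𝟙 (i ≟ a) ≡ 1
∑-𝟙≡ n {a} a<n = ≤-antisym (∑-𝟙≡-≤1 n a)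
  (≤-trans (≤-reflexive (sym (𝟙-yes (a ≟ a) refl))) (term≤∑ n (λ i → 𝟙 (i ≟ a)) a<n))

𝟙+𝟙+≤1 : ∀ {q} {Q : Set q} (d : Dec P) (d′ : Dec Q) {x} → x ≤ 1 →
          (P → ¬ Q) → (P → x ≡ 0) → (Q → x ≡ 0) → 𝟙 d + 𝟙 d′ + x ≤ 1
𝟙+𝟙+≤1 (yes p) (yes q) _   p⇒¬q _   _   = ⊥-elim (p⇒¬q p q)
𝟙+𝟙+≤1 (yes p) (no _)  _   _    p⇒0 _   = ≤-reflexive (cong suc (p⇒0 p))
𝟙+𝟙+≤1 (no _)  (yes q) _   _    _   q⇒0 = ≤-reflexive (cong suc (q⇒0 q))
𝟙+𝟙+≤1 (no _)  (no _)  x≤1 _    _   _   = x≤1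

𝟙+𝟙+-pos : ∀ {q} {Q : Set q} (d : Dec P) (d′ : Dec Q) {x} → 0 < 𝟙 d + 𝟙 d′ + x → P ⊎ Q ⊎ 0 < x
𝟙+𝟙+-pos (yes p) _       _   = inj₁ p
𝟙+𝟙+-pos (no _)  (yes q) _   = inj₂ (inj₁ q)
𝟙+𝟙+-pos (no _)  (no _)  pos = inj₂ (inj₂ pos)

∑ᴸ : List A → (A → ℕ) → ℕ
∑ᴸ []       f = 0
∑ᴸ (x ∷ xs) f = f x + ∑ᴸ xs f

syntax ∑ᴸ xs (λ x → e) = ∑[ x ∈ xs ] e

module _ {A : Set p} where

  ∑ᴸ-cong : ∀ (xs : List A) {f g} → (∀ x → f x ≡ g x) → ∑ᴸ xs f ≡ ∑ᴸ xs g
  ∑ᴸ-cong []       _ = refl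
  ∑ᴸ-cong (x ∷ xs) h = cong₂ _+_ (h x) (∑ᴸ-cong xs h)

  ∑ᴸ-mono-≤ : ∀ (xs : List A) {f g} → (∀ x → f x ≤ g x) → ∑ᴸ xs f ≤ ∑ᴸ xs g
  ∑ᴸ-mono-≤ []       _ = z≤n
  ∑ᴸ-mono-≤ (x ∷ xs) h = +-mono-≤ (h x) (∑ᴸ-mono-≤ xs h)

  ∑ᴸ-const : ∀ (xs : List A) c → ∑[ _ ∈ xs ] c ≡ length xs * c
  ∑ᴸ-const []       c = refl
  ∑ᴸ-const (x ∷ xs) c = cong (c +_) (∑ᴸ-const xs c)

  ∑-∑ᴸ-comm : ∀ n (xs : List A) (f : ℕ → A → ℕ) → ∑[ i < n ] ∑ᴸ xs (f i) ≡ ∑[ x ∈ xs ] ∑[ i < n ] f i x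
  ∑-∑ᴸ-comm n []       f = ∑-const n 0 ⟨ trans ⟩ *-zeroʳ n
  ∑-∑ᴸ-comm n (x ∷ xs) f =
    trans (∑-distrib-+ n (λ i → f i x) (λ i → ∑ᴸ xs (f i))) (cong (∑[ i < n ] f i x +_) (∑-∑ᴸ-comm n xs f))

  term≤∑ᴸ : ∀ (xs : List A) f {x} → x ∈ xs → f x ≤ ∑ᴸ xs f
  term≤∑ᴸ (x ∷ xs) f (here refl) = m≤m+n (f x) (∑ᴸ xs f)
  term≤∑ᴸ (y ∷ xs) f (there x∈)  = ≤-trans (term≤∑ᴸ xs f x∈) (m≤n+m (∑ᴸ xs f) (f y))

  ∑ᴸ-pos : ∀ (xs : List A) f → 0 < ∑ᴸ xs f → ∃[ x ] x ∈ xs × 0 < f x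
  ∑ᴸ-pos (x ∷ xs) f h with f x in eq
  ... | suc _ = x , here refl , subst (0 <_) (sym eq) (s≤s z≤n)
  ... | zero  with ∑ᴸ-pos xs f h
  ...   | y , y∈ , fy>0 = y , there y∈ , fy>0

  ∑ᴸ-𝟙 : ∀ {P : A → Set p} (P? : ∀ x → Dec (P x)) xs → ∑[ x ∈ xs ] 𝟙 (P? x) ≡ length (filter P? xs)
  ∑ᴸ-𝟙 P? []       = refl
  ∑ᴸ-𝟙 P? (x ∷ xs) with P? x
  ... | yes _ = cong suc (∑ᴸ-𝟙 P? xs)
  ... | no  _ = ∑ᴸ-𝟙 P? xs

  ∑ᴸ-zero : ∀ (xs : List A) {f} → (∀ {x} → x ∈ xs → f x ≡ 0) → ∑ᴸ xs f ≡ 0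
  ∑ᴸ-zero []       _ = refl
  ∑ᴸ-zero (x ∷ xs) h = cong₂ _+_ (h (here refl)) (∑ᴸ-zero xs (h ∘ there))

  ∑ᴸ-≤1 : ∀ {xs : List A} f → Unique xs → (∀ x → f x ≤ 1) →
          (∀ {x y} → x ∈ xs → y ∈ xs → 0 < f x → 0 < f y → x ≡ y) → ∑ᴸ xs f ≤ 1
  ∑ᴸ-≤1 {[]}     f _          _   _      = z≤n
  ∑ᴸ-≤1 {x ∷ xs} f (x∉ ∷ !xs) f≤1 unique with f x in eq
  ... | zero  = ∑ᴸ-≤1 f !xs f≤1 (λ x∈ y∈ → unique (there x∈) (there y∈))
  ... | suc k = subst (λ s → suc k + s ≤ 1) (sym (∑ᴸ-zero xs vanish))
                  (subst (_≤ 1) (eq ⟨ trans ⟩ sym (+-identityʳ (suc k))) (f≤1 x))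
    where
    vanish : ∀ {y} → y ∈ xs → f y ≡ 0
    vanish {y} y∈ with f y in eqy
    ... | zero  = refl
    ... | suc _ = ⊥-elim (All.lookup x∉ y∈ (unique (here refl) (there y∈)
                    (subst (0 <_) (sym eq) (s≤s z≤n)) (subst (0 <_) (sym eqy) (s≤s z≤n))))

multiplicity : List ℕ → ℕ → ℕ
multiplicity xs i = ∑[ x ∈ xs ] 𝟙 (i ≟ x)

∈⇒0<multiplicity : ∀ {xs i} → i ∈ xs → 0 < multiplicity xs i
∈⇒0<multiplicity {xs} {i} i∈ =
  ≤-trans (≤-reflexive (sym (𝟙-yes (i ≟ i) refl))) (term≤∑ᴸ xs (λ x → 𝟙 (i ≟ x)) i∈)

∑-multiplicity≤length : ∀ n xs → ∑[ i < n ] multiplicity xs i ≤ length xs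
∑-multiplicity≤length n xs = begin
  ∑[ i < n ] ∑[ x ∈ xs ] 𝟙 (i ≟ x) ≡⟨ ∑-∑ᴸ-comm n xs _ ⟩
  ∑[ x ∈ xs ] ∑[ i < n ] 𝟙 (i ≟ x) ≤⟨ ∑ᴸ-mono-≤ xs (∑-𝟙≡-≤1 n) ⟩
  ∑[ _ ∈ xs ] 1                    ≡⟨ ∑ᴸ-const xs 1 ⟨ trans ⟩ *-identityʳ _ ⟩
  length xs                        ∎
  where open ≤-Reasoning

∑-cover-except : ∀ n {Q : ℕ → Set p} (Q? : ∀ i → Dec (Q i)) xs →
                 (∀ i → i < n → Q i ⊎ i ∈ xs) → n ≤ ∑[ i < n ] 𝟙 (Q? i) + length xs
∑-cover-except n Q? xs cover = begin
  n                                                  ≤⟨ ∑-cover n _ pos ⟩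
  ∑[ i < n ] (𝟙 (Q? i) + multiplicity xs i)          ≡⟨ ∑-distrib-+ n _ _ ⟩
  ∑[ i < n ] 𝟙 (Q? i) + ∑[ i < n ] multiplicity xs i ≤⟨ +-monoʳ-≤ _ (∑-multiplicity≤length n xs) ⟩
  ∑[ i < n ] 𝟙 (Q? i) + length xs                    ∎
  where
  open ≤-Reasoning
  pos : ∀ i → i < n → 0 < 𝟙 (Q? i) + multiplicity xs i
  pos i i<n with cover i i<n
  ... | inj₁ q  = ≤-trans (≤-reflexive (sym (𝟙-yes (Q? i) q))) (m≤m+n _ _)
  ... | inj₂ i∈ = ≤-trans (∈⇒0<multiplicity i∈) (m≤n+m _ _)

∑-𝟙≤length : ∀ n {Q : ℕ → Set p} (Q? : ∀ i → Dec (Q i)) xs →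
             (∀ i → i < n → Q i → i ∈ xs) → ∑[ i < n ] 𝟙 (Q? i) ≤ length xs
∑-𝟙≤length n Q? xs covered = ≤-trans (∑-mono-≤ n bound) (∑-multiplicity≤length n xs)
  where
  bound : ∀ i → i < n → 𝟙 (Q? i) ≤ multiplicity xs i
  bound i i<n with Q? i
  ... | yes q = ∈⇒0<multiplicity (covered i i<n q)
  ... | no  _ = z≤n

∑-𝟙∈ : ∀ n {xs} → Unique xs → All (_< n) xs → ∑[ i < n ] 𝟙 (i ∈? xs) ≡ length xs
∑-𝟙∈ n {[]}     _          _            = ∑-const n 0 ⟨ trans ⟩ *-zeroʳ n
∑-𝟙∈ n {x ∷ xs} (x∉ ∷ !xs) (x<n ∷ xs<n) = begin
  ∑[ i < n ] 𝟙 (i ∈? x ∷ xs)                     ≡⟨ ∑-cong n (λ i _ → 𝟙-∈-∷ i) ⟩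
  ∑[ i < n ] (𝟙 (i ≟ x) + 𝟙 (i ∈? xs))           ≡⟨ ∑-distrib-+ n _ _ ⟩
  ∑[ i < n ] 𝟙 (i ≟ x) + ∑[ i < n ] 𝟙 (i ∈? xs) ≡⟨ cong₂ _+_ (∑-𝟙≡ n x<n) (∑-𝟙∈ n !xs xs<n) ⟩
  1 + length xs                                   ∎
  where
  open ≡-Reasoning
  𝟙-∈-∷ : ∀ i → 𝟙 (i ∈? x ∷ xs) ≡ 𝟙 (i ≟ x) + 𝟙 (i ∈? xs)
  𝟙-∈-∷ i = split (i ≟ x) (i ∈? xs)
    where
    split : (i≟x : Dec (i ≡ x)) (i∈?xs : Dec (i ∈ xs)) → 𝟙 (i ∈? x ∷ xs) ≡ 𝟙 i≟x + 𝟙 i∈?xs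
    split (yes i≡x) (yes i∈) = ⊥-elim (All.lookup x∉ (subst (_∈ xs) i≡x i∈) refl)
    split (yes i≡x) (no _)   = 𝟙-yes (i ∈? x ∷ xs) (here i≡x)
    split (no _)    (yes i∈) = 𝟙-yes (i ∈? x ∷ xs) (there i∈)
    split (no i≢x)  (no i∉)  = 𝟙-no (i ∈? x ∷ xs) λ { (here i≡x) → i≢x i≡x ; (there i∈) → i∉ i∈ }

module _ {A : Set p} (_≟ₐ_ : DecidableEquality A) where

  length-mono-⊆ : ∀ {xs ys : List A} → Unique xs → (∀ {x} → x ∈ xs → x ∈ ys) → length xs ≤ length ys
  length-mono-⊆ {[]}         _          _     = z≤n
  length-mono-⊆ {x ∷ xs} {ys} (x∉ ∷ !xs) xs⊆ys = ≤-trans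
    (s≤s (length-mono-⊆ !xs (λ y∈ → ∈-filter⁺ (λ y → ¬? (x ≟ₐ y)) (xs⊆ys (there y∈)) (All.lookup x∉ y∈))))
    (filter-notAll (λ y → ¬? (x ≟ₐ y)) ys (Any.map (λ x≡y x≢y → x≢y x≡y) (xs⊆ys (here refl))))

infixl 5 _─_

_─_ : List ℕ → ℕ → List ℕ
xs ─ u = filter (λ w → ¬? (w ≟ u)) xs

∈-─⁺ : ∀ {xs u w} → w ∈ xs → ¬ w ≡ u → w ∈ xs ─ u
∈-─⁺ {u = u} = ∈-filter⁺ (λ w → ¬? (w ≟ u))

∈-─⁻ : ∀ xs {u w} → w ∈ xs ─ u → w ∈ xs × ¬ w ≡ u
∈-─⁻ xs {u} = ∈-filter⁻ (λ w → ¬? (w ≟ u)) {xs = xs}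

Unique-─ : ∀ {xs} u → Unique xs → Unique (xs ─ u)
Unique-─ u = Unique.filter⁺ (λ w → ¬? (w ≟ u))

All-─ : ∀ {P : ℕ → Set p} {xs} u → All P xs → All P (xs ─ u)
All-─ u = All.filter⁺ (λ w → ¬? (w ≟ u))

length-─ : ∀ {xs u} → Unique xs → u ∈ xs → suc (length (xs ─ u)) ≡ length xs
length-─ {x ∷ xs} (x∉ ∷ _) (here refl) = cong suc (begin
  length ((x ∷ xs) ─ x) ≡⟨ cong length (filter-reject (λ w → ¬? (w ≟ x)) λ x≢x → x≢x refl) ⟩
  length (xs ─ x)       ≡⟨ cong length (filter-all (λ w → ¬? (w ≟ x)) (All.map (λ x≢w w≡x → x≢w (sym w≡x)) x∉)) ⟩
  length xs             ∎)
  where open ≡-Reasoning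
length-─ {x ∷ xs} {u} (x∉ ∷ !xs) (there u∈) =
  trans (cong (suc ∘ length) (filter-accept (λ w → ¬? (w ≟ u)) x≢u)) (cong suc (length-─ !xs u∈))
  where
  x≢u : ¬ x ≡ u
  x≢u refl = All.lookup x∉ u∈ refl

-- Codegrees and the upper bound

[_,_,_] : ℕ → ℕ → ℕ → List ℕ
[ x , y , z ] = x ∷ y ∷ z ∷ []

data Perm₃ (u v w : ℕ) : ℕ → ℕ → ℕ → Set where
  p123 : Perm₃ u v w u v w
  p132 : Perm₃ u v w u w v
  p213 : Perm₃ u v w v u w
  p231 : Perm₃ u v w v w u
  p312 : Perm₃ u v w w u v
  p321 : Perm₃ u v w w v u

Perm₃-sym : ∀ {u v w x y z} → Perm₃ u v w x y z → Perm₃ x y z u v w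
Perm₃-sym p123 = p123
Perm₃-sym p132 = p132
Perm₃-sym p213 = p213
Perm₃-sym p231 = p312
Perm₃-sym p312 = p231
Perm₃-sym p321 = p321

module _ {ℓ} (R : ℕ → ℕ → ℕ → Set ℓ)
         (swap₁₂ : ∀ {x y z} → R x y z → R y x z) (swap₂₃ : ∀ {x y z} → R x y z → R x z y) where

  Perm₃-transport : ∀ {u v w x y z} → Perm₃ u v w x y z → R u v w → R x y z
  Perm₃-transport p123 = λ r → r
  Perm₃-transport p132 = swap₂₃
  Perm₃-transport p213 = swap₁₂
  Perm₃-transport p231 = swap₂₃ ∘ swap₁₂
  Perm₃-transport p312 = swap₁₂ ∘ swap₂₃
  Perm₃-transport p321 = swap₁₂ ∘ swap₂₃ ∘ swap₁₂

∈-Perm₃ : ∀ {u v w x y z s} → Perm₃ u v w x y z → s ∈ [ u , v , w ] → s ∈ [ x , y , z ]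
∈-Perm₃ {s = s} = Perm₃-transport (λ x y z → s ∈ [ x , y , z ]) swap₁₂ swap₂₃
  where
  swap₁₂ : ∀ {x y z} → s ∈ [ x , y , z ] → s ∈ [ y , x , z ]
  swap₁₂ (here s≡x)                = there (here s≡x)
  swap₁₂ (there (here s≡y))        = here s≡y
  swap₁₂ (there (there s∈z))       = there (there s∈z)
  swap₂₃ : ∀ {x y z} → s ∈ [ x , y , z ] → s ∈ [ x , z , y ]
  swap₂₃ (here s≡x)                = here s≡x
  swap₂₃ (there (here s≡y))        = there (there (here s≡y))
  swap₂₃ (there (there (here s≡z))) = there (here s≡z)

Distinct₃ : ℕ → ℕ → ℕ → Set
Distinct₃ u v w = ¬ u ≡ v × ¬ v ≡ w × ¬ u ≡ w

Perm₃-from-∈ : ∀ {u v w x y z} → Distinct₃ u v w →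
               u ∈ [ x , y , z ] → v ∈ [ x , y , z ] → w ∈ [ x , y , z ] → Perm₃ u v w x y z
Perm₃-from-∈ {u} {v} {w} (u≢v , v≢w , u≢w) = arrange
  where
  arrange : ∀ {x y z} → u ∈ [ x , y , z ] → v ∈ [ x , y , z ] → w ∈ [ x , y , z ] → Perm₃ u v w x y z
  arrange (here refl)                (there (here refl))        (there (there (here refl))) = p123
  arrange (here refl)                (there (there (here refl))) (there (here refl))        = p132
  arrange (there (here refl))        (here refl)                (there (there (here refl))) = p213
  arrange (there (there (here refl))) (here refl)                (there (here refl))        = p231
  arrange (there (here refl))        (there (there (here refl))) (here refl)                = p312
  arrange (there (there (here refl))) (there (here refl))        (here refl)                = p321
  arrange (here refl)                (here refl)                _                          = ⊥-elim (u≢v refl)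
  arrange (there (here refl))        (there (here refl))        _                          = ⊥-elim (u≢v refl)
  arrange (there (there (here refl))) (there (there (here refl))) _                         = ⊥-elim (u≢v refl)
  arrange _ (here refl)                (here refl)                = ⊥-elim (v≢w refl)
  arrange _ (there (here refl))        (there (here refl))        = ⊥-elim (v≢w refl)
  arrange _ (there (there (here refl))) (there (there (here refl))) = ⊥-elim (v≢w refl)
  arrange (here refl)                _ (here refl)                = ⊥-elim (u≢w refl)
  arrange (there (here refl))        _ (there (here refl))        = ⊥-elim (u≢w refl)
  arrange (there (there (here refl))) _ (there (there (here refl))) = ⊥-elim (u≢w refl)

sorted-Perm₃ : ∀ {x y z x′ y′ z′} → x < y → y < z → x′ < y′ → y′ < z′ →
               Perm₃ x y z x′ y′ z′ → x ≡ x′ × y ≡ y′ × z ≡ z′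
sorted-Perm₃ _   _   _   _   p123 = refl , refl , refl
sorted-Perm₃ _   y<z _   z<y p132 = ⊥-elim (<-asym y<z z<y)
sorted-Perm₃ x<y _   y<x _   p213 = ⊥-elim (<-asym x<y y<x)
sorted-Perm₃ x<y y<z _   z<x p231 = ⊥-elim (<-asym (<-trans x<y y<z) z<x)
sorted-Perm₃ x<y y<z z<x _   p312 = ⊥-elim (<-asym (<-trans x<y y<z) z<x)
sorted-Perm₃ _   y<z z<y _   p321 = ⊥-elim (<-asym y<z z<y)

sort₃ : ∀ {u v w} → Distinct₃ u v w → ∃[ x ] ∃[ y ] ∃[ z ] x < y × y < z × Perm₃ u v w x y z
sort₃ {u} {v} {w} (u≢v , v≢w , u≢w) with <-cmp u v | <-cmp v w | <-cmp u w
... | tri≈ _ u≡v _ | _            | _            = ⊥-elim (u≢v u≡v)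
... | _            | tri≈ _ v≡w _ | _            = ⊥-elim (v≢w v≡w)
... | _            | _            | tri≈ _ u≡w _ = ⊥-elim (u≢w u≡w)
... | tri< u<v _ _ | tri< v<w _ _ | _            = u , v , w , u<v , v<w , p123
... | tri< _ _ _   | tri> _ _ w<v | tri< u<w _ _ = u , w , v , u<w , w<v , p132
... | tri< u<v _ _ | tri> _ _ _   | tri> _ _ w<u = w , u , v , w<u , u<v , p312
... | tri> _ _ v<u | tri< _ _ _   | tri< u<w _ _ = v , u , w , v<u , u<w , p213
... | tri> _ _ _   | tri< v<w _ _ | tri> _ _ w<u = v , w , u , v<w , w<u , p231
... | tri> _ _ v<u | tri> _ _ w<v | _            = w , v , u , w<v , v<u , p321

𝟙-× : ∀ {q} {Q : Set q} (d : Dec P) (d′ : Dec Q) → 𝟙 (d ×-dec d′) ≡ 𝟙 d * 𝟙 d′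
𝟙-× (yes _) (yes _) = refl
𝟙-× (yes _) (no _)  = refl
𝟙-× (no _)  _       = refl

𝟙*-cong : ∀ (d : Dec P) {x y} → (P → x ≡ y) → 𝟙 d * x ≡ 𝟙 d * y
𝟙*-cong (yes p) h = cong (_+ 0) (h p)
𝟙*-cong (no _)  _ = refl

∑-𝟙-× : ∀ n {q} {Q : ℕ → Set q} (d : Dec P) (Q? : ∀ i → Dec (Q i)) →
        ∑[ i < n ] 𝟙 (d ×-dec Q? i) ≡ 𝟙 d * ∑[ i < n ] 𝟙 (Q? i)
∑-𝟙-× n d Q? = ∑-cong n (λ i _ → 𝟙-× d (Q? i)) ⟨ trans ⟩ ∑-distribˡ-* n (𝟙 d) (𝟙 ∘ Q?)

centre leaf₁ leaf₂ : Fin 3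
centre = Fin.zero
leaf₁  = Fin.suc Fin.zero
leaf₂  = Fin.suc (Fin.suc Fin.zero)

module _ {n : ℕ} where

  verts : Triple n → List ℕ
  verts e = [ toℕ (a e) , toℕ (b e) , toℕ (c e) ]

  Unique-verts : ∀ e → Unique (verts e)
  Unique-verts (triple _ _ _ a<b b<c) = (<⇒≢ a<b ∷ <⇒≢ (<-trans a<b b<c) ∷ []) ∷ (<⇒≢ b<c ∷ []) ∷ [] ∷ []

  verts<n : ∀ e → All (_< n) (verts e)
  verts<n e = toℕ<n (a e) ∷ toℕ<n (b e) ∷ toℕ<n (c e) ∷ []

  ∈ᵥ⇒∈verts : ∀ {U : Fin n} {e} → U ∈ᵥ e → toℕ U ∈ verts e
  ∈ᵥ⇒∈verts (inj₁ U≡a)        = here (cong toℕ U≡a)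
  ∈ᵥ⇒∈verts (inj₂ (inj₁ U≡b)) = there (here (cong toℕ U≡b))
  ∈ᵥ⇒∈verts (inj₂ (inj₂ U≡c)) = there (there (here (cong toℕ U≡c)))

  ∈verts⇒∈ᵥ : ∀ {U : Fin n} {e} → toℕ U ∈ verts e → U ∈ᵥ e
  ∈verts⇒∈ᵥ (here eq)                 = inj₁ (toℕ-injective eq)
  ∈verts⇒∈ᵥ (there (here eq))         = inj₂ (inj₁ (toℕ-injective eq))
  ∈verts⇒∈ᵥ (there (there (here eq))) = inj₂ (inj₂ (toℕ-injective eq))

  triple-≡ : ∀ {e e′ : Triple n} → a e ≡ a e′ → b e ≡ b e′ → c e ≡ c e′ → e ≡ e′
  triple-≡ {triple x y z _ _} {triple _ _ _ _ _} refl refl refl =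
    cong₂ (triple x y z) (<-irrelevant _ _) (<-irrelevant _ _)

  _≟ₜ_ : DecidableEquality (Triple n)
  e ≟ₜ e′ with a e ≟ᶠ a e′ | b e ≟ᶠ b e′ | c e ≟ᶠ c e′
  ... | yes a≡ | yes b≡ | yes c≡ = yes (triple-≡ a≡ b≡ c≡)
  ... | no a≢  | _      | _      = no (a≢ ∘ cong a)
  ... | yes _  | no b≢  | _      = no (b≢ ∘ cong b)
  ... | yes _  | yes _  | no c≢  = no (c≢ ∘ cong c)

  verts-injective : ∀ {e e′ : Triple n} {u v w} → Distinct₃ u v w →
                    u ∈ verts e → v ∈ verts e → w ∈ verts e →
                    u ∈ verts e′ → v ∈ verts e′ → w ∈ verts e′ → e ≡ e′
  verts-injective {e@(triple _ _ _ a<b b<c)} {e′@(triple _ _ _ a<b′ b<c′)} d u∈ v∈ w∈ u∈′ v∈′ w∈′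
    with sorted-Perm₃ a<b b<c a<b′ b<c′
           (Perm₃-from-∈ sorted-distinct (move (here refl)) (move (there (here refl))) (move (there (there (here refl)))))
    where
    sorted-distinct : Distinct₃ (toℕ (a e)) (toℕ (b e)) (toℕ (c e))
    sorted-distinct = <⇒≢ a<b , <⇒≢ b<c , <⇒≢ (<-trans a<b b<c)
    move : ∀ {s} → s ∈ verts e → s ∈ verts e′
    move = ∈-Perm₃ (Perm₃-from-∈ d u∈′ v∈′ w∈′) ∘ ∈-Perm₃ (Perm₃-sym (Perm₃-from-∈ d u∈ v∈ w∈))
  ... | a≡ , b≡ , c≡ = triple-≡ (toℕ-injective a≡) (toℕ-injective b≡) (toℕ-injective c≡)

  Contains₂ : Triple n → ℕ → ℕ → Set
  Contains₂ e u v = u ∈ verts e × v ∈ verts e ─ u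

  contains₂? : ∀ e u v → Dec (Contains₂ e u v)
  contains₂? e u v = u ∈? verts e ×-dec v ∈? verts e ─ u

  Contains₃ : Triple n → ℕ → ℕ → ℕ → Set
  Contains₃ e u v w = Contains₂ e u v × w ∈ verts e ─ u ─ v

  contains₃? : ∀ e u v w → Dec (Contains₃ e u v w)
  contains₃? e u v w = contains₂? e u v ×-dec w ∈? verts e ─ u ─ v

  codegree : List (Triple n) → ℕ → ℕ → ℕ
  codegree E u v = ∑[ e ∈ E ] 𝟙 (contains₂? e u v)

  codegree₃ : List (Triple n) → ℕ → ℕ → ℕ → ℕ
  codegree₃ E u v w = ∑[ e ∈ E ] 𝟙 (contains₃? e u v w)

  Contains₃⇒∈ : ∀ {e u v w} → Contains₃ e u v w →
                Distinct₃ u v w × u ∈ verts e × v ∈ verts e × w ∈ verts e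
  Contains₃⇒∈ {e} {u} {v} ((u∈ , v∈e─u) , w∈e─u─v)
    with ∈-─⁻ (verts e) v∈e─u | ∈-─⁻ (verts e ─ u) w∈e─u─v
  ... | v∈ , v≢u | w∈e─u , w≢v with ∈-─⁻ (verts e) w∈e─u
  ...   | w∈ , w≢u = (v≢u ∘ sym , w≢v ∘ sym , w≢u ∘ sym) , u∈ , v∈ , w∈

  ∈⇒Contains₃ : ∀ {e u v w} → Distinct₃ u v w → u ∈ verts e → v ∈ verts e → w ∈ verts e → Contains₃ e u v w
  ∈⇒Contains₃ (u≢v , v≢w , u≢w) u∈ v∈ w∈ =
    (u∈ , ∈-─⁺ v∈ (u≢v ∘ sym)) , ∈-─⁺ (∈-─⁺ w∈ (u≢w ∘ sym)) (v≢w ∘ sym)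

  ∑-𝟙∈verts : ∀ e → ∑[ u < n ] 𝟙 (u ∈? verts e) ≡ 3
  ∑-𝟙∈verts e = ∑-𝟙∈ n (Unique-verts e) (verts<n e)

  ∑-contains₂ : ∀ e u → ∑[ v < n ] 𝟙 (contains₂? e u v) ≡ 2 * 𝟙 (u ∈? verts e)
  ∑-contains₂ e u = begin
    ∑[ v < n ] 𝟙 (contains₂? e u v)            ≡⟨ ∑-𝟙-× n (u ∈? verts e) (_∈? verts e ─ u) ⟩
    𝟙 (u ∈? verts e) * ∑[ v < n ] 𝟙 (v ∈? verts e ─ u) ≡⟨ 𝟙*-cong (u ∈? verts e) two-others ⟩
    𝟙 (u ∈? verts e) * 2                        ≡⟨ *-comm (𝟙 (u ∈? verts e)) 2 ⟩
    2 * 𝟙 (u ∈? verts e)                        ∎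
    where
    open ≡-Reasoning
    two-others : u ∈ verts e → ∑[ v < n ] 𝟙 (v ∈? verts e ─ u) ≡ 2
    two-others u∈ = ∑-𝟙∈ n (Unique-─ u (Unique-verts e)) (All-─ u (verts<n e))
             ⟨ trans ⟩ suc-injective (length-─ (Unique-verts e) u∈)

  ∑-contains₃ : ∀ e u v → ∑[ w < n ] 𝟙 (contains₃? e u v w) ≡ 𝟙 (contains₂? e u v)
  ∑-contains₃ e u v = begin
    ∑[ w < n ] 𝟙 (contains₃? e u v w)                          ≡⟨ ∑-𝟙-× n (contains₂? e u v) (_∈? verts e ─ u ─ v) ⟩
    𝟙 (contains₂? e u v) * ∑[ w < n ] 𝟙 (w ∈? verts e ─ u ─ v) ≡⟨ 𝟙*-cong (contains₂? e u v) one-left ⟩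
    𝟙 (contains₂? e u v) * 1                                    ≡⟨ *-identityʳ _ ⟩
    𝟙 (contains₂? e u v)                                        ∎
    where
    open ≡-Reasoning
    one-left : Contains₂ e u v → ∑[ w < n ] 𝟙 (w ∈? verts e ─ u ─ v) ≡ 1
    one-left (u∈ , v∈) = ∑-𝟙∈ n (Unique-─ v (Unique-─ u (Unique-verts e))) (All-─ v (All-─ u (verts<n e)))
      ⟨ trans ⟩ suc-injective (length-─ (Unique-─ u (Unique-verts e)) v∈
                               ⟨ trans ⟩ suc-injective (length-─ (Unique-verts e) u∈))

  handshake : ∀ E → ∑[ u < n ] ∑[ v < n ] codegree E u v ≡ 6 * length E
  handshake E = begin
    ∑[ u < n ] ∑[ v < n ] ∑[ e ∈ E ] 𝟙 (contains₂? e u v) ≡⟨ ∑-cong n (λ u _ → ∑-∑ᴸ-comm n E _) ⟩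
    ∑[ u < n ] ∑[ e ∈ E ] ∑[ v < n ] 𝟙 (contains₂? e u v) ≡⟨ ∑-∑ᴸ-comm n E _ ⟩
    ∑[ e ∈ E ] ∑[ u < n ] ∑[ v < n ] 𝟙 (contains₂? e u v) ≡⟨ ∑ᴸ-cong E six ⟩
    ∑[ _ ∈ E ] 6                                           ≡⟨ ∑ᴸ-const E 6 ⟨ trans ⟩ *-comm (length E) 6 ⟩
    6 * length E                                           ∎
    where
    open ≡-Reasoning
    six : ∀ e → ∑[ u < n ] ∑[ v < n ] 𝟙 (contains₂? e u v) ≡ 6
    six e = ∑-cong n (λ u _ → ∑-contains₂ e u) ⟨ trans ⟩ ∑-distribˡ-* n 2 _ ⟨ trans ⟩ cong (2 *_) (∑-𝟙∈verts e)

  ∑-codegree₃ : ∀ E u v → ∑[ w < n ] codegree₃ E u v w ≡ codegree E u v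
  ∑-codegree₃ E u v = ∑-∑ᴸ-comm n E _ ⟨ trans ⟩ ∑ᴸ-cong E (λ e → ∑-contains₃ e u v)

  codegree₃≤1 : ∀ {E} → Unique E → ∀ u v w → codegree₃ E u v w ≤ 1
  codegree₃≤1 {E} !E u v w = ∑ᴸ-≤1 _ !E (λ e → 𝟙≤1 (contains₃? e u v w)) same
    where
    same : ∀ {e e′} → e ∈ E → e′ ∈ E → 0 < 𝟙 (contains₃? e u v w) → 0 < 𝟙 (contains₃? e′ u v w) → e ≡ e′
    same {e} {e′} _ _ c c′ with Contains₃⇒∈ {e} (𝟙-witness (contains₃? e u v w) c)
                              | Contains₃⇒∈ {e′} (𝟙-witness (contains₃? e′ u v w) c′)
    ... | d , u∈ , v∈ , w∈ | _ , u∈′ , v∈′ , w∈′ = verts-injective d u∈ v∈ w∈ u∈′ v∈′ w∈′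

  codegree≤n : ∀ {E} → Unique E → ∀ u v → codegree E u v ≤ n
  codegree≤n {E} !E u v = begin
    codegree E u v            ≡⟨ sym (∑-codegree₃ E u v) ⟩
    ∑[ w < n ] codegree₃ E u v w ≤⟨ ∑-mono-≤ n (λ w _ → codegree₃≤1 !E u v w) ⟩
    ∑[ _ < n ] 1              ≡⟨ ∑-const n 1 ⟨ trans ⟩ *-identityʳ n ⟩
    n                         ∎
    where open ≤-Reasoning

  codegree-self : ∀ E u → codegree E u u ≡ 0
  codegree-self E u = ∑ᴸ-zero E λ {e} _ →
    𝟙-no (contains₂? e u u) λ (_ , u∈e─u) → proj₂ (∈-─⁻ (verts e) u∈e─u) refl

  HeavyEdge⇒≤codegree : ∀ {t f} {H : Hypergraph n} (i : Fin f → Fin n) x y → ¬ i x ≡ i y →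
                        HeavyEdge t H i (x , y) → t ≤ codegree (edges H) (toℕ (i x)) (toℕ (i y))
  HeavyEdge⇒≤codegree {H = H} i x y ix≢iy (L , refl , !L , L⊆E , L∋xy) =
    subst (length L ≤_) (sym (∑ᴸ-𝟙 through? (edges H)))
      (length-mono-⊆ _≟ₜ_ !L λ e∈L → ∈-filter⁺ through? (All.lookup L⊆E e∈L) (through e∈L))
    where
    through? : ∀ e → Dec (Contains₂ e (toℕ (i x)) (toℕ (i y)))
    through? e = contains₂? e (toℕ (i x)) (toℕ (i y))
    through : ∀ {e} → e ∈ L → Contains₂ e (toℕ (i x)) (toℕ (i y))
    through {e} e∈L with All.lookup L∋xy e∈L
    ... | x∈ , y∈ = ∈ᵥ⇒∈verts {e = e} x∈ , ∈-─⁺ (∈ᵥ⇒∈verts {e = e} y∈) (ix≢iy ∘ sym ∘ toℕ-injective)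

  ≤codegree⇒HeavyEdge : ∀ {t f} (H : Hypergraph n) (i : Fin f → Fin n) x y →
                        t ≤ codegree (edges H) (toℕ (i x)) (toℕ (i y)) → HeavyEdge t H i (x , y)
  ≤codegree⇒HeavyEdge {t} H i x y t≤ =
    take t L , trans (length-take t L) (m≤n⇒m⊓n≡m (subst (t ≤_) (∑ᴸ-𝟙 through? (edges H)) t≤)) ,
    Unique.take⁺ t (Unique.filter⁺ through? (distinct H)) ,
    All.take⁺ t (All.tabulate (proj₁ ∘ ∈-filter⁻ through? {xs = edges H})) ,
    All.take⁺ t (All.tabulate λ {e} → incident {e} ∘ proj₂ ∘ ∈-filter⁻ through? {xs = edges H})
    where
    through? : ∀ e → Dec (Contains₂ e (toℕ (i x)) (toℕ (i y)))
    through? e = contains₂? e (toℕ (i x)) (toℕ (i y))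
    L : List (Triple n)
    L = filter through? (edges H)
    incident : ∀ {e} → Contains₂ e (toℕ (i x)) (toℕ (i y)) → i x ∈ᵥ e × i y ∈ᵥ e
    incident {e} (x∈ , y∈e─x) = ∈verts⇒∈ᵥ {e = e} x∈ , ∈verts⇒∈ᵥ {e = e} (proj₁ (∈-─⁻ (verts e) y∈e─x))

  HeavyCherry : ℕ → List (Triple n) → Set
  HeavyCherry t E = ∃[ u ] ∃[ v ] ∃[ w ] (u < n × v < n × w < n) × Distinct₃ u v w ×
                                          t ≤ codegree E u v × t ≤ codegree E u w

  S₂⇒HeavyCherry : ∀ {t} {H : Hypergraph n} → ContainsHeavy t S₂ H → HeavyCherry t (edges H)
  S₂⇒HeavyCherry {H = H} (i , i-inj , heavy₁ ∷ heavy₂ ∷ []) =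
    toℕ (i centre) , toℕ (i leaf₁) , toℕ (i leaf₂) , (toℕ<n _ , toℕ<n _ , toℕ<n _) ,
    (0≢1 ∘ i-inj ∘ toℕ-injective , 1≢2 ∘ i-inj ∘ toℕ-injective , 0≢2 ∘ i-inj ∘ toℕ-injective) ,
    HeavyEdge⇒≤codegree {H = H} i centre leaf₁ (0≢1 ∘ i-inj) heavy₁ ,
    HeavyEdge⇒≤codegree {H = H} i centre leaf₂ (0≢2 ∘ i-inj) heavy₂
    where
    0≢1 : ¬ centre ≡ leaf₁
    0≢1 ()
    1≢2 : ¬ leaf₁ ≡ leaf₂
    1≢2 ()
    0≢2 : ¬ centre ≡ leaf₂
    0≢2 ()

  HeavyCherry⇒S₂ : ∀ {t} (H : Hypergraph n) → HeavyCherry t (edges H) → ContainsHeavy t S₂ H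
  HeavyCherry⇒S₂ {t} H (u , v , w , (u<n , v<n , w<n) , (u≢v , v≢w , u≢w) , t≤uv , t≤uw) =
    ι , ι-injective , heavy leaf₁ t≤uv ∷ heavy leaf₂ t≤uw ∷ []
    where
    label : Fin 3 → ℕ
    label Fin.zero                     = u
    label (Fin.suc Fin.zero)           = v
    label (Fin.suc (Fin.suc Fin.zero)) = w
    label<n : ∀ x → label x < n
    label<n Fin.zero                     = u<n
    label<n (Fin.suc Fin.zero)           = v<n
    label<n (Fin.suc (Fin.suc Fin.zero)) = w<n
    label-injective : ∀ {x y} → label x ≡ label y → x ≡ y
    label-injective {Fin.zero}                     {Fin.zero}                     _ = refl
    label-injective {Fin.suc Fin.zero}             {Fin.suc Fin.zero}             _ = refl
    label-injective {Fin.suc (Fin.suc Fin.zero)}   {Fin.suc (Fin.suc Fin.zero)}   _ = refl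
    label-injective {Fin.zero}                     {Fin.suc Fin.zero}             e = ⊥-elim (u≢v e)
    label-injective {Fin.zero}                     {Fin.suc (Fin.suc Fin.zero)}   e = ⊥-elim (u≢w e)
    label-injective {Fin.suc Fin.zero}             {Fin.zero}                     e = ⊥-elim (u≢v (sym e))
    label-injective {Fin.suc Fin.zero}             {Fin.suc (Fin.suc Fin.zero)}   e = ⊥-elim (v≢w e)
    label-injective {Fin.suc (Fin.suc Fin.zero)}   {Fin.zero}                     e = ⊥-elim (u≢w (sym e))
    label-injective {Fin.suc (Fin.suc Fin.zero)}   {Fin.suc Fin.zero}             e = ⊥-elim (v≢w (sym e))
    ι : Fin 3 → Fin n
    ι x = fromℕ< (label<n x)
    toℕ-ι : ∀ x → toℕ (ι x) ≡ label x
    toℕ-ι x = toℕ-fromℕ< (label<n x)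
    ι-injective : ∀ {x y} → ι x ≡ ι y → x ≡ y
    ι-injective {x} {y} ιx≡ιy = label-injective (trans (sym (toℕ-ι x)) (trans (cong toℕ ιx≡ιy) (toℕ-ι y)))
    heavy : ∀ y → t ≤ codegree (edges H) u (label y) → HeavyEdge t H ι (centre , y)
    heavy y t≤ = ≤codegree⇒HeavyEdge H ι centre y
      (subst₂ (λ p q → t ≤ codegree (edges H) p q) (sym (toℕ-ι centre)) (sym (toℕ-ι y)) t≤)

  codegree-row≤ : ∀ {t} (H : Hypergraph n) → ¬ HeavyCherry (suc t) (edges H) →
                  ∀ {u} → u < n → ∑[ v < n ] codegree (edges H) u v ≤ suc t * n
  codegree-row≤ {t} H no-cherry {u} u<n with anyUpTo? (λ v → suc t ≤? codegree (edges H) u v) n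
  ... | no no-heavy = begin
    ∑[ v < n ] codegree (edges H) u v ≤⟨ ∑-mono-≤ n (λ v v<n → <⇒≤ (≰⇒> (no-heavy ∘ (v ,_) ∘ (v<n ,_)))) ⟩
    ∑[ _ < n ] suc t                  ≡⟨ ∑-const n (suc t) ⟨ trans ⟩ *-comm n (suc t) ⟩
    suc t * n                         ∎
    where open ≤-Reasoning
  ... | yes (v₀ , v₀<n , heavy₀) = begin
    ∑[ v < n ] codegree (edges H) u v          ≤⟨ ∑-mono-≤ n (λ v v<n → light-except-v₀ v v<n) ⟩
    ∑[ v < n ] (t + n * 𝟙 (v ≟ v₀))            ≡⟨ ∑-distrib-+ n _ _ ⟩
    ∑[ _ < n ] t + ∑[ v < n ] (n * 𝟙 (v ≟ v₀)) ≡⟨ cong (_ +_) (∑-distribˡ-* n n _) ⟩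
    ∑[ _ < n ] t + n * ∑[ v < n ] 𝟙 (v ≟ v₀)   ≡⟨ cong₂ (λ x y → x + n * y) (∑-const n t) (∑-𝟙≡ n v₀<n) ⟩
    n * t + n * 1                              ≡⟨ rearrange n t ⟩
    suc t * n                                  ∎
    where
    open ≤-Reasoning
    rearrange : ∀ n t → n * t + n * 1 ≡ suc t * n
    rearrange = solve-∀
    u≢ : ∀ {v} → suc t ≤ codegree (edges H) u v → ¬ u ≡ v
    u≢ heavy refl = 1+n≰n (≤-trans (s≤s z≤n) (≤-trans heavy (≤-reflexive (codegree-self (edges H) u))))
    light-except-v₀ : ∀ v → v < n → codegree (edges H) u v ≤ t + n * 𝟙 (v ≟ v₀)
    light-except-v₀ v v<n with v ≟ v₀ | suc t ≤? codegree (edges H) u v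
    ... | yes refl | _         = ≤-trans (codegree≤n (distinct H) u v)
                                   (≤-trans (≤-reflexive (trans (sym (*-identityʳ n)) (cong (n *_) (sym (𝟙-yes (v ≟ v) refl)))))
                                            (m≤n+m _ t))
    ... | no _     | no light  = ≤-trans (≤-pred (≰⇒> light)) (m≤m+n t _)
    ... | no v≢v₀  | yes heavy = ⊥-elim (no-cherry (u , v₀ , v , (u<n , v₀<n , v<n) ,
                                   (u≢ heavy₀ , v≢v₀ ∘ sym , u≢ heavy) , heavy₀ , heavy))

  upper-bound : ∀ {t} (H : Hypergraph n) → ¬ ContainsHeavy (suc t) S₂ H → 6 * ∣ H ∣ₑ ≤ suc t * n ^ 2
  upper-bound {t} H S₂-free = begin
    6 * ∣ H ∣ₑ                                     ≡⟨ sym (handshake (edges H)) ⟩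
    ∑[ u < n ] ∑[ v < n ] codegree (edges H) u v ≤⟨ ∑-mono-≤ n (λ _ → codegree-row≤ H (S₂-free ∘ HeavyCherry⇒S₂ H)) ⟩
    ∑[ _ < n ] (suc t * n)                         ≡⟨ ∑-const n (suc t * n) ⟩
    n * (suc t * n)                                ≡⟨ square n (suc t) ⟩
    suc t * n ^ 2                                  ∎
    where
    open ≤-Reasoning
    square : ∀ n s → n * (s * n) ≡ s * (n * (n * 1))
    square = solve-∀

  fromSorted : ∀ {x y z} → x < y → y < z → z < n → Triple n
  fromSorted {x} {y} {z} x<y y<z z<n = triple (fromℕ< x<n) (fromℕ< y<n) (fromℕ< z<n)
    (subst₂ _<_ (sym (toℕ-fromℕ< x<n)) (sym (toℕ-fromℕ< y<n)) x<y)
    (subst₂ _<_ (sym (toℕ-fromℕ< y<n)) (sym (toℕ-fromℕ< z<n)) y<z)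
    where
    y<n = <-trans y<z z<n
    x<n = <-trans x<y y<n

  verts-fromSorted : ∀ {x y z} (x<y : x < y) (y<z : y < z) (z<n : z < n) → verts (fromSorted x<y y<z z<n) ≡ [ x , y , z ]
  verts-fromSorted x<y y<z z<n =
    cong₂ _∷_ (toℕ-fromℕ< _) (cong₂ _∷_ (toℕ-fromℕ< _) (cong₂ _∷_ (toℕ-fromℕ< z<n) refl))

  sortedTriple : Fin n → Fin n → Fin n → List (Triple n)
  sortedTriple x y z with x <?ᶠ y | y <?ᶠ z
  ... | yes x<y | yes y<z = triple x y z x<y y<z ∷ []
  ... | _       | _       = []

  ∈-sortedTriple : ∀ e → e ∈ sortedTriple (a e) (b e) (c e)
  ∈-sortedTriple (triple x y z x<y y<z) with x <?ᶠ y | y <?ᶠ z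
  ... | yes _    | yes _    = here (triple-≡ refl refl refl)
  ... | no x≮y   | _        = ⊥-elim (x≮y x<y)
  ... | yes _    | no y≮z   = ⊥-elim (y≮z y<z)

  allTriples : List (Triple n)
  allTriples = concatMap (λ x → concatMap (λ y → concatMap (sortedTriple x y) (allFin n)) (allFin n)) (allFin n)

  ∈-allTriples : ∀ e → e ∈ allTriples
  ∈-allTriples e =
    ∈-concatMap⁺ _ (Any.map (λ { refl →
    ∈-concatMap⁺ _ (Any.map (λ { refl →
    ∈-concatMap⁺ _ (Any.map (λ { refl → ∈-sortedTriple e }) (∈-allFin (c e))) }) (∈-allFin (b e))) }) (∈-allFin (a e)))

-- The lower-bound construction

module HypergraphOf {n : ℕ} (R : ℕ → ℕ → ℕ → Set) (R? : ∀ u v w → Dec (R u v w))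
                    (swap₁₂ : ∀ {u v w} → R u v w → R v u w) (swap₂₃ : ∀ {u v w} → R u v w → R u w v)
                    (R⇒Distinct₃ : ∀ {u v w} → R u v w → Distinct₃ u v w) where

  Rₜ : Triple n → Set
  Rₜ e = R (toℕ (a e)) (toℕ (b e)) (toℕ (c e))

  Rₜ? : ∀ e → Dec (Rₜ e)
  Rₜ? e = R? (toℕ (a e)) (toℕ (b e)) (toℕ (c e))

  hyperedges : List (Triple n)
  hyperedges = deduplicate _≟ₜ_ (filter Rₜ? allTriples)

  Unique-hyperedges : Unique hyperedges
  Unique-hyperedges = deduplicate-! (filter Rₜ? allTriples)
    where open import Data.List.Relation.Unary.Unique.DecPropositional.Properties _≟ₜ_ using (deduplicate-!)

  hypergraphOf : Hypergraph n
  hypergraphOf = hypergraph hyperedges Unique-hyperedges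

  ∈-hyperedges⁻ : ∀ {e} → e ∈ hyperedges → Rₜ e
  ∈-hyperedges⁻ e∈ = proj₂ (∈-filter⁻ Rₜ? {xs = allTriples} (∈-deduplicate⁻ _≟ₜ_ (filter Rₜ? allTriples) e∈))

  ∈-hyperedges⁺ : ∀ {e} → Rₜ e → e ∈ hyperedges
  ∈-hyperedges⁺ {e} Re = ∈-deduplicate⁺ _≟ₜ_ (∈-filter⁺ Rₜ? (∈-allTriples e) Re)

  R-cong : ∀ {u v w u′ v′ w′} → u ≡ u′ → v ≡ v′ → w ≡ w′ → R u v w → R u′ v′ w′
  R-cong refl refl refl r = r

  codegree₃≤𝟙R : ∀ u v w → codegree₃ hyperedges u v w ≤ 𝟙 (R? u v w)
  codegree₃≤𝟙R u v w = ≤𝟙 (R? u v w) (codegree₃≤1 Unique-hyperedges u v w) λ pos →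
    let e , e∈ , contains = ∑ᴸ-pos hyperedges _ pos
        d , u∈ , v∈ , w∈   = Contains₃⇒∈ {e = e} (𝟙-witness (contains₃? e u v w) contains)
    in Perm₃-transport R swap₁₂ swap₂₃ (Perm₃-sym (Perm₃-from-∈ d u∈ v∈ w∈)) (∈-hyperedges⁻ e∈)

  𝟙R≤codegree₃ : ∀ {u v w} → u < n → v < n → w < n → 𝟙 (R? u v w) ≤ codegree₃ hyperedges u v w
  𝟙R≤codegree₃ {u} {v} {w} u<n v<n w<n with R? u v w
  ... | no _  = z≤n
  ... | yes r with sort₃ (R⇒Distinct₃ r)
  ...   | x , y , z , x<y , y<z , p = ≤-trans (≤-reflexive (sym (𝟙-yes (contains₃? e u v w) contains)))
                                        (term≤∑ᴸ hyperedges (λ e → 𝟙 (contains₃? e u v w)) (∈-hyperedges⁺ {e} Re))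
    where
    z<n : z < n
    z<n = All.lookup (u<n ∷ v<n ∷ w<n ∷ []) (∈-Perm₃ (Perm₃-sym p) (there (there (here refl))))
    e : Triple n
    e = fromSorted x<y y<z z<n
    Re : Rₜ e
    Re = R-cong (sym (toℕ-fromℕ< _)) (sym (toℕ-fromℕ< _)) (sym (toℕ-fromℕ< _)) (Perm₃-transport R swap₁₂ swap₂₃ p r)
    ∈e : ∀ {s} → s ∈ [ u , v , w ] → s ∈ verts e
    ∈e {s} s∈ = subst (s ∈_) (sym (verts-fromSorted x<y y<z z<n)) (∈-Perm₃ p s∈)
    contains : Contains₃ e u v w
    contains = ∈⇒Contains₃ {e = e} (R⇒Distinct₃ r) (∈e (here refl)) (∈e (there (here refl))) (∈e (there (there (here refl))))

  codegree-hyperedges : ∀ {u v} → u < n → v < n → codegree hyperedges u v ≡ ∑[ w < n ] 𝟙 (R? u v w)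
  codegree-hyperedges {u} {v} u<n v<n = trans (sym (∑-codegree₃ hyperedges u v))
    (∑-cong n λ w w<n → ≤-antisym (codegree₃≤𝟙R u v w) (𝟙R≤codegree₃ u<n v<n w<n))

  size-hyperedges : 6 * length hyperedges ≡ ∑[ u < n ] ∑[ v < n ] ∑[ w < n ] 𝟙 (R? u v w)
  size-hyperedges = trans (sym (handshake hyperedges))
    (∑-cong n λ u u<n → ∑-cong n λ v v<n → codegree-hyperedges u<n v<n)

double/2 : ∀ x → (x + x) / 2 ≡ x
double/2 x = trans (cong (_/ 2) (trans (cong (x +_) (sym (+-identityʳ x))) (*-comm 2 x))) (m*n/n≡m x 2)

module Modular (N : ℕ) .{{_ : NonZero N}} where

  %-absorbˡ : ∀ x y → (x % N + y) % N ≡ (x + y) % N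
  %-absorbˡ x y = begin
    (x % N + y) % N           ≡⟨ %-distribˡ-+ (x % N) y N ⟩
    (x % N % N + y % N) % N   ≡⟨ cong (λ r → (r + y % N) % N) (m%n%n≡m%n x N) ⟩
    (x % N + y % N) % N       ≡⟨ %-distribˡ-+ x y N ⟨
    (x + y) % N               ∎
    where open ≡-Reasoning

  %-absorbʳ : ∀ x y → (x + y % N) % N ≡ (x + y) % N
  %-absorbʳ x y = begin
    (x + y % N) % N ≡⟨ cong (_% N) (+-comm x (y % N)) ⟩
    (y % N + x) % N ≡⟨ %-absorbˡ y x ⟩
    (y + x) % N     ≡⟨ cong (_% N) (+-comm y x) ⟩
    (x + y) % N     ∎
    where open ≡-Reasoning

  +-complement : ∀ K → K + (N ∸ K % N) ≡ suc (K / N) * N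
  +-complement K = begin
    K + (N ∸ K % N)                   ≡⟨ cong (_+ (N ∸ K % N)) (m≡m%n+[m/n]*n K N ⟨ trans ⟩ +-comm (K % N) _) ⟩
    K / N * N + K % N + (N ∸ K % N)   ≡⟨ +-assoc (K / N * N) (K % N) (N ∸ K % N) ⟩
    K / N * N + (K % N + (N ∸ K % N)) ≡⟨ cong (K / N * N +_) (m+[n∸m]≡n (m%n≤n K N)) ⟩
    K / N * N + N                     ≡⟨ +-comm (K / N * N) N ⟩
    suc (K / N) * N                   ∎
    where open ≡-Reasoning

  infixl 6 _∸ₘ_

  _∸ₘ_ : ℕ → ℕ → ℕ
  c ∸ₘ K = (c + (N ∸ K % N)) % N

  ∸ₘ<N : ∀ c K → c ∸ₘ K < N
  ∸ₘ<N c K = m%n<n (c + (N ∸ K % N)) N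

  +-∸ₘ-cancel : ∀ K x → (x + K + (N ∸ K % N)) % N ≡ x % N
  +-∸ₘ-cancel K x = begin
    (x + K + (N ∸ K % N)) % N   ≡⟨ cong (_% N) (+-assoc x K _) ⟩
    (x + (K + (N ∸ K % N))) % N ≡⟨ cong (λ y → (x + y) % N) (+-complement K) ⟩
    (x + suc (K / N) * N) % N   ≡⟨ [m+kn]%n≡m%n x (suc (K / N)) N ⟩
    x % N                       ∎
    where open ≡-Reasoning

  +-∸ₘ : ∀ K {c} → c < N → (K + (c ∸ₘ K)) % N ≡ c
  +-∸ₘ K {c} c<N = begin
    (K + (c + (N ∸ K % N)) % N) % N ≡⟨ %-absorbʳ K (c + (N ∸ K % N)) ⟩
    (K + (c + (N ∸ K % N))) % N     ≡⟨ cong (_% N) (sym (+-assoc K c _) ⟨ trans ⟩ cong (_+ (N ∸ K % N)) (+-comm K c)) ⟩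
    (c + K + (N ∸ K % N)) % N       ≡⟨ +-∸ₘ-cancel K c ⟩
    c % N                           ≡⟨ m<n⇒m%n≡m c<N ⟩
    c                               ∎
    where open ≡-Reasoning

  +-∸ₘ-inverse : ∀ K {x} → x < N → (K + x) % N ∸ₘ K ≡ x
  +-∸ₘ-inverse K {x} x<N = begin
    ((K + x) % N + (N ∸ K % N)) % N ≡⟨ %-absorbˡ (K + x) _ ⟩
    (K + x + (N ∸ K % N)) % N       ≡⟨ cong (λ y → (y + (N ∸ K % N)) % N) (+-comm K x) ⟩
    (x + K + (N ∸ K % N)) % N       ≡⟨ +-∸ₘ-cancel K x ⟩
    x % N                           ≡⟨ m<n⇒m%n≡m x<N ⟩
    x                               ∎
    where open ≡-Reasoning

  +-cancelˡ-% : ∀ K {x y} → x < N → y < N → (K + x) % N ≡ (K + y) % N → x ≡ y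
  +-cancelˡ-% K x<N y<N eq = trans (sym (+-∸ₘ-inverse K x<N)) (trans (cong (_∸ₘ K) eq) (+-∸ₘ-inverse K y<N))

  %≡⇒≡∸ₘ : ∀ K {x c} → x < N → (K + x) % N ≡ c → x ≡ c ∸ₘ K
  %≡⇒≡∸ₘ K x<N K+x≡c = trans (sym (+-∸ₘ-inverse K x<N)) (cong (_∸ₘ K) K+x≡c)

  halve : ∀ {x h} → x < N → (x + x) % N ≡ h → x ≡ h / 2 ⊎ x ≡ (h + N) / 2
  halve {x} {h} x<N x+x≡h with (x + x) / N | m<n*o⇒m/o<n {x + x} {2} {N} x+x<2N | m≡m%n+[m/n]*n (x + x) N
    where
    x+x<2N : x + x < 2 * N
    x+x<2N = subst (x + x <_) (cong (N +_) (sym (+-identityʳ N))) (+-mono-< x<N x<N)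
  ... | 0 | _ | x+x≡ = inj₁ (trans (sym (double/2 x)) (cong (_/ 2) (trans x+x≡ (trans (+-identityʳ _) x+x≡h))))
  ... | 1 | _ | x+x≡ = inj₂ (trans (sym (double/2 x)) (cong (_/ 2) (trans x+x≡ (cong₂ _+_ x+x≡h (+-identityʳ N)))))
  ... | suc (suc _) | s≤s (s≤s ()) | _

module Construction (m T : ℕ) where

  M N : ℕ
  M = suc m
  N = 2 * M

  open Modular N

  M<N : M < N
  M<N = m<m+n M (s≤s z≤n)

  pair : ℕ → ℕ
  pair u = u % M

  partner : ℕ → ℕ
  partner u = (u + M) % N

  partner<N : ∀ u → partner u < N
  partner<N u = m%n<n (u + M) N

  pair-partner : ∀ u → pair (partner u) ≡ pair u
  pair-partner u = trans (m∣n⇒o%n%m≡o%m M N (u + M) (divides 2 refl)) ([m+n]%n≡m%n u M)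

  partner≢ : ∀ {u} → u < N → ¬ partner u ≡ u
  partner≢ {u} u<N p≡u = 1+n≢0 (+-cancelˡ-% u M<N (s≤s z≤n) (begin
    (u + M) % N ≡⟨ p≡u ⟩
    u           ≡⟨ m<n⇒m%n≡m u<N ⟨
    u % N       ≡⟨ cong (_% N) (+-identityʳ u) ⟨
    (u + 0) % N ∎))
    where open ≡-Reasoning

  pair⊎pair+M : ∀ {x} → x < N → x ≡ pair x ⊎ x ≡ pair x + M
  pair⊎pair+M {x} x<N with x / M | m<n*o⇒m/o<n {x} {2} {M} x<N | m≡m%n+[m/n]*n x M
  ... | 0 | _ | x≡ = inj₁ (trans x≡ (+-identityʳ (pair x)))
  ... | 1 | _ | x≡ = inj₂ (trans x≡ (cong (pair x +_) (+-identityʳ M)))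
  ... | suc (suc _) | s≤s (s≤s ()) | _

  same-pair⇒partner : ∀ {w u} → w < N → u < N → pair w ≡ pair u → ¬ w ≡ u → w ≡ partner u
  same-pair⇒partner {w} {u} w<N u<N pw≡pu w≢u with pair⊎pair+M w<N | pair⊎pair+M u<N
  ... | inj₁ w≡ | inj₁ u≡ = ⊥-elim (w≢u (trans w≡ (trans pw≡pu (sym u≡))))
  ... | inj₂ w≡ | inj₂ u≡ = ⊥-elim (w≢u (trans w≡ (trans (cong (_+ M) pw≡pu) (sym u≡))))
  ... | inj₂ w≡ | inj₁ u≡ = begin
    w                 ≡⟨ m<n⇒m%n≡m w<N ⟨
    w % N             ≡⟨ cong (_% N) (trans w≡ (cong (_+ M) (trans pw≡pu (sym u≡)))) ⟩
    (u + M) % N       ∎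
    where open ≡-Reasoning
  ... | inj₁ w≡ | inj₂ u≡ = begin
    w                 ≡⟨ m<n⇒m%n≡m w<N ⟨
    w % N             ≡⟨ [m+n]%n≡m%n w N ⟨
    (w + N) % N       ≡⟨ cong (_% N) (trans (cong (_+ N) (trans w≡ pw≡pu)) (sym (+-assoc (pair u) M (M + 0)))) ⟩
    (pair u + M + (M + 0)) % N ≡⟨ cong (λ x → (x + (M + 0)) % N) (sym u≡) ⟩
    (u + (M + 0)) % N ≡⟨ cong (λ x → (u + x) % N) (+-identityʳ M) ⟩
    (u + M) % N       ∎
    where open ≡-Reasoning

  σ : ℕ → ℕ → ℕ → ℕ
  σ u v w = (u + v + w) % N

  third : ℕ → ℕ → ℕ → ℕ
  third u v s = s ∸ₘ (u + v)

  third<N : ∀ u v s → third u v s < N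
  third<N u v s = ∸ₘ<N s (u + v)

  σ-third : ∀ u v {s} → s < N → σ u v (third u v s) ≡ s
  σ-third u v = +-∸ₘ (u + v)

  σ-injective : ∀ u v {w w′} → w < N → w′ < N → σ u v w ≡ σ u v w′ → w ≡ w′
  σ-injective u v = +-cancelˡ-% (u + v)

  σ-swap₁₂ : ∀ u v w → σ v u w ≡ σ u v w
  σ-swap₁₂ u v w = cong (λ x → (x + w) % N) (+-comm v u)

  σ-swap₂₃ : ∀ u v w → σ u w v ≡ σ u v w
  σ-swap₂₃ u v w = cong (_% N) (trans (+-assoc u w v) (trans (cong (u +_) (+-comm w v)) (sym (+-assoc u v w))))

  SamePair : ℕ → ℕ → Set
  SamePair x y = pair x ≡ pair y

  Edge : ℕ → ℕ → ℕ → Set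
  Edge u v w = Distinct₃ u v w × (u < N × v < N × w < N) ×
               (SamePair u v ⊎ SamePair v w ⊎ SamePair u w ⊎ σ u v w < T)

  Edge? : ∀ u v w → Dec (Edge u v w)
  Edge? u v w = (¬? (u ≟ v) ×-dec ¬? (v ≟ w) ×-dec ¬? (u ≟ w)) ×-dec
                (u <? N ×-dec v <? N ×-dec w <? N) ×-dec
                (pair u ≟ pair v ⊎-dec pair v ≟ pair w ⊎-dec pair u ≟ pair w ⊎-dec σ u v w <? T)

  Edge-swap₁₂ : ∀ {u v w} → Edge u v w → Edge v u w
  Edge-swap₁₂ {u} {v} {w} ((u≢v , v≢w , u≢w) , (u<N , v<N , w<N) , kind) =
    (u≢v ∘ sym , u≢w , v≢w) , (v<N , u<N , w<N) , swap kind
    where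
    swap : SamePair u v ⊎ SamePair v w ⊎ SamePair u w ⊎ σ u v w < T →
           SamePair v u ⊎ SamePair u w ⊎ SamePair v w ⊎ σ v u w < T
    swap (inj₁ uv)                 = inj₁ (sym uv)
    swap (inj₂ (inj₁ vw))          = inj₂ (inj₂ (inj₁ vw))
    swap (inj₂ (inj₂ (inj₁ uw)))   = inj₂ (inj₁ uw)
    swap (inj₂ (inj₂ (inj₂ σ<T)))  = inj₂ (inj₂ (inj₂ (subst (_< T) (sym (σ-swap₁₂ u v w)) σ<T)))

  Edge-swap₂₃ : ∀ {u v w} → Edge u v w → Edge u w v
  Edge-swap₂₃ {u} {v} {w} ((u≢v , v≢w , u≢w) , (u<N , v<N , w<N) , kind) =
    (u≢w , v≢w ∘ sym , u≢v) , (u<N , w<N , v<N) , swap kind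
    where
    swap : SamePair u v ⊎ SamePair v w ⊎ SamePair u w ⊎ σ u v w < T →
           SamePair u w ⊎ SamePair w v ⊎ SamePair u v ⊎ σ u w v < T
    swap (inj₁ uv)                 = inj₂ (inj₂ (inj₁ uv))
    swap (inj₂ (inj₁ vw))          = inj₂ (inj₁ (sym vw))
    swap (inj₂ (inj₂ (inj₁ uw)))   = inj₁ uw
    swap (inj₂ (inj₂ (inj₂ σ<T)))  = inj₂ (inj₂ (inj₂ (subst (_< T) (sym (σ-swap₂₃ u v w)) σ<T)))

  module OnVertices (n : ℕ) = HypergraphOf {n} Edge Edge? Edge-swap₁₂ Edge-swap₂₃ proj₁

  Edge⇒third : ∀ {u v w} → Edge u v w → ¬ SamePair u v → w ∈ partner u ∷ partner v ∷ applyUpTo (third u v) T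
  Edge⇒third {u} {v} {w} ((u≢v , v≢w , u≢w) , (u<N , v<N , w<N) , kind) u≁v with kind
  ... | inj₁ uv                = ⊥-elim (u≁v uv)
  ... | inj₂ (inj₁ vw)         = there (here (same-pair⇒partner w<N v<N (sym vw) (v≢w ∘ sym)))
  ... | inj₂ (inj₂ (inj₁ uw))  = here (same-pair⇒partner w<N u<N (sym uw) (u≢w ∘ sym))
  ... | inj₂ (inj₂ (inj₂ σ<T)) = there (there (subst (_∈ applyUpTo (third u v) T)
                                   (σ-injective u v (third<N u v (σ u v w)) w<N (σ-third u v (m%n<n (u + v + w) N)))
                                   (∈-applyUpTo⁺ (third u v) σ<T)))

  codegree-unpaired : ∀ n {u v} → ¬ SamePair u v → ∑[ w < n ] 𝟙 (Edge? u v w) ≤ 2 + T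
  codegree-unpaired n {u} {v} u≁v =
    ≤-trans (∑-𝟙≤length n (Edge? u v) _ (λ _ _ → flip Edge⇒third u≁v))
            (≤-reflexive (cong (2 +_) (length-applyUpTo (third u v) T)))

  heavy⇒partner : ∀ n {u v} → 3 + T ≤ ∑[ w < n ] 𝟙 (Edge? u v w) → v ≡ partner u
  heavy⇒partner n {u} {v} heavy with pair u ≟ pair v
  ... | no u≁v = ⊥-elim (1+n≰n (≤-trans heavy (codegree-unpaired n {u} {v} u≁v)))
  ... | yes u∼v with ∑-pos n _ (≤-trans (s≤s z≤n) heavy)
  ...   | w , _ , edge with 𝟙-witness (Edge? u v w) edge
  ...     | (u≢v , _ , _) , (u<N , v<N , _) , _ = same-pair⇒partner v<N u<N (sym u∼v) (u≢v ∘ sym)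

  S₂-free : ∀ n → ¬ ContainsHeavy (3 + T) S₂ (OnVertices.hypergraphOf n)
  S₂-free n heavy with S₂⇒HeavyCherry {H = OnVertices.hypergraphOf n} heavy
  ... | u , v , w , (u<n , v<n , w<n) , (_ , v≢w , _) , heavy-v , heavy-w =
    v≢w (trans (heavy⇒partner n {u} {v} (subst (3 + T ≤_) (codegree-hyperedges u<n v<n) heavy-v))
         (sym (heavy⇒partner n {u} {w} (subst (3 + T ≤_) (codegree-hyperedges u<n w<n) heavy-w))))
    where open OnVertices n

  Spread : ℕ → ℕ → ℕ → Set
  Spread u v s = ¬ SamePair v u × ¬ SamePair (third u v s) u × ¬ SamePair (third u v s) v

  Spread? : ∀ u v s → Dec (Spread u v s)
  Spread? u v s = ¬? (pair v ≟ pair u) ×-dec ¬? (pair (third u v s) ≟ pair u) ×-dec ¬? (pair (third u v s) ≟ pair v)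

  module LowerBound (T≤N : T ≤ N) {u : ℕ} (u<N : u < N) where

    s<N : ∀ {s} → s < T → s < N
    s<N s<T = <-≤-trans s<T T≤N

    partner-row : N ≤ ∑[ w < N ] 𝟙 (Edge? u (partner u) w) + 2
    partner-row = ∑-cover-except N (Edge? u (partner u)) (u ∷ partner u ∷ []) cover
      where
      cover : ∀ w → w < N → Edge u (partner u) w ⊎ w ∈ u ∷ partner u ∷ []
      cover w w<N with w ≟ u | w ≟ partner u
      ... | yes w≡u | _       = inj₂ (here w≡u)
      ... | no _    | yes w≡p = inj₂ (there (here w≡p))
      ... | no w≢u  | no w≢p  = inj₁ ((partner≢ u<N ∘ sym , w≢p ∘ sym , w≢u ∘ sym) ,
                                      (u<N , partner<N u , w<N) , inj₁ (sym (pair-partner u)))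

    unpaired-count : N ≤ ∑[ v < N ] 𝟙 (¬? (pair v ≟ pair u)) + 2
    unpaired-count = ∑-cover-except N (λ v → ¬? (pair v ≟ pair u)) (u ∷ partner u ∷ []) cover
      where
      cover : ∀ v → v < N → ¬ SamePair v u ⊎ v ∈ u ∷ partner u ∷ []
      cover v v<N with pair v ≟ pair u | v ≟ u
      ... | no v≁u  | _       = inj₁ v≁u
      ... | yes _   | yes v≡u = inj₂ (here v≡u)
      ... | yes v∼u | no v≢u  = inj₂ (there (here (same-pair⇒partner v<N u<N v∼u v≢u)))

    -- v fails to spread the sum s when it lies in the pair of u, or when the third vertex lies in
    -- the pair of u or of v; solving σ u v w ≡ s for v in each case leaves these eight candidates.
    excluded : ℕ → List ℕ
    excluded s = u ∷ partner u ∷ s ∸ₘ (u + u) ∷ s ∸ₘ (u + partner u) ∷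
                 h₁ / 2 ∷ (h₁ + N) / 2 ∷ h₂ / 2 ∷ (h₂ + N) / 2 ∷ []
      where
      h₁ = s ∸ₘ u
      h₂ = s ∸ₘ (u + M)

    third≡⇒ : ∀ {v s x} → v < N → s < N → third u v s ≡ x → v ≡ s ∸ₘ (u + x)
    third≡⇒ {v} {s} {x} v<N s<N t≡x = %≡⇒≡∸ₘ (u + x) v<N (begin
      (u + x + v) % N ≡⟨ cong (_% N) (+-comm-right u x v) ⟩
      (u + v + x) % N ≡⟨ cong (σ u v) t≡x ⟨
      σ u v (third u v s) ≡⟨ σ-third u v s<N ⟩
      s ∎)
      where
      open ≡-Reasoning
      +-comm-right : ∀ a b c → a + b + c ≡ a + c + b
      +-comm-right = solve-∀

    double≡ : ∀ {K v s} → (K + (v + v)) % N ≡ s → (v + v) % N ≡ s ∸ₘ K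
    double≡ {K} {v} eq = %≡⇒≡∸ₘ K (m%n<n (v + v) N) (trans (%-absorbʳ K (v + v)) eq)

    third≡self⇒ : ∀ {v s} → v < N → s < N → third u v s ≡ v → v ≡ (s ∸ₘ u) / 2 ⊎ v ≡ (s ∸ₘ u + N) / 2
    third≡self⇒ {v} {s} v<N s<N t≡v = halve v<N (double≡ {u} {v} (begin
      (u + (v + v)) % N   ≡⟨ cong (_% N) (+-assoc u v v) ⟨
      (u + v + v) % N     ≡⟨ cong (σ u v) t≡v ⟨
      σ u v (third u v s) ≡⟨ σ-third u v s<N ⟩
      s                   ∎))
      where open ≡-Reasoning

    third≡partner⇒ : ∀ {v s} → v < N → s < N → third u v s ≡ partner v →
                     v ≡ (s ∸ₘ (u + M)) / 2 ⊎ v ≡ (s ∸ₘ (u + M) + N) / 2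
    third≡partner⇒ {v} {s} v<N s<N t≡p = halve v<N (double≡ {u + M} {v} (begin
      (u + M + (v + v)) % N       ≡⟨ cong (_% N) (rearrange u v M) ⟩
      (u + v + (v + M)) % N       ≡⟨ %-absorbʳ (u + v) (v + M) ⟨
      σ u v (partner v)           ≡⟨ cong (σ u v) t≡p ⟨
      σ u v (third u v s)         ≡⟨ σ-third u v s<N ⟩
      s                           ∎))
      where
      open ≡-Reasoning
      rearrange : ∀ a b c → a + c + (b + b) ≡ a + b + (b + c)
      rearrange = solve-∀

    unspread⇒excluded : ∀ {v s} → v < N → s < N → ¬ Spread u v s → v ∈ excluded s
    unspread⇒excluded {v} {s} v<N s<N unspread
      with pair v ≟ pair u | pair (third u v s) ≟ pair u | pair (third u v s) ≟ pair v
    ... | yes v∼u | _ | _ with v ≟ u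
    ...   | yes v≡u = here v≡u
    ...   | no v≢u  = there (here (same-pair⇒partner v<N u<N v∼u v≢u))
    unspread⇒excluded {v} {s} v<N s<N unspread | no _ | yes t∼u | _ with third u v s ≟ u
    ...   | yes t≡u = there (there (here (third≡⇒ v<N s<N t≡u)))
    ...   | no t≢u  = there (there (there (here (third≡⇒ v<N s<N
                        (same-pair⇒partner (third<N u v s) u<N t∼u t≢u)))))
    unspread⇒excluded {v} {s} v<N s<N unspread | no _ | no _ | yes t∼v with third u v s ≟ v
    ...   | yes t≡v with third≡self⇒ v<N s<N t≡v
    ...     | inj₁ v≡ = there (there (there (there (here v≡))))
    ...     | inj₂ v≡ = there (there (there (there (there (here v≡)))))
    unspread⇒excluded {v} {s} v<N s<N unspread | no _ | no _ | yes t∼v | no t≢v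
      with third≡partner⇒ v<N s<N (same-pair⇒partner (third<N u v s) v<N t∼v t≢v)
    ...     | inj₁ v≡ = there (there (there (there (there (there (here v≡))))))
    ...     | inj₂ v≡ = there (there (there (there (there (there (there (here v≡)))))))
    unspread⇒excluded v<N s<N unspread | no v≁u | no t≁u | no t≁v = ⊥-elim (unspread (v≁u , t≁u , t≁v))

    spread-count : ∀ {s} → s < T → N ≤ ∑[ v < N ] 𝟙 (Spread? u v s) + 8
    spread-count {s} s<T = ∑-cover-except N (λ v → Spread? u v s) (excluded s) cover
      where
      cover : ∀ v → v < N → Spread u v s ⊎ v ∈ excluded s
      cover v v<N with Spread? u v s
      ... | yes spread = inj₁ spread
      ... | no unspread = inj₂ (unspread⇒excluded v<N (s<N s<T) unspread)

    module Unpaired {v : ℕ} (v<N : v < N) (v≁u : ¬ SamePair v u) where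

      u≢v : ¬ u ≡ v
      u≢v = v≁u ∘ cong pair ∘ sym

      edge-partner-u : Edge u v (partner u)
      edge-partner-u = (u≢v , v≁u ∘ (_⟨ trans ⟩ pair-partner u) ∘ cong pair , partner≢ u<N ∘ sym) ,
                       (u<N , v<N , partner<N u) , inj₂ (inj₂ (inj₁ (sym (pair-partner u))))

      edge-partner-v : Edge u v (partner v)
      edge-partner-v = (u≢v , partner≢ v<N ∘ sym , v≁u ∘ sym ∘ (_⟨ trans ⟩ pair-partner v) ∘ cong pair) ,
                       (u<N , v<N , partner<N v) , inj₂ (inj₁ (sym (pair-partner v)))

      edge-third : ∀ {s} → s < T → Spread u v s → Edge u v (third u v s)
      edge-third {s} s<T (_ , t≁u , t≁v) =
        (u≢v , t≁v ∘ cong pair ∘ sym , t≁u ∘ cong pair ∘ sym) , (u<N , v<N , third<N u v s) ,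
        inj₂ (inj₂ (inj₂ (subst (_< T) (sym (σ-third u v (s<N s<T))) s<T)))

      thirds : ℕ → ℕ
      thirds w = ∑[ s < T ] 𝟙 (Spread? u v s ×-dec w ≟ third u v s)

      ∑-thirds : ∑[ w < N ] thirds w ≡ ∑[ s < T ] 𝟙 (Spread? u v s)
      ∑-thirds = trans (∑-comm N T _) (∑-cong T λ s _ → begin
        ∑[ w < N ] 𝟙 (Spread? u v s ×-dec w ≟ third u v s)   ≡⟨ ∑-𝟙-× N (Spread? u v s) (_≟ third u v s) ⟩
        𝟙 (Spread? u v s) * ∑[ w < N ] 𝟙 (w ≟ third u v s) ≡⟨ cong (𝟙 (Spread? u v s) *_) (∑-𝟙≡ N (third<N u v s)) ⟩
        𝟙 (Spread? u v s) * 1                                ≡⟨ *-identityʳ _ ⟩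
        𝟙 (Spread? u v s)                                    ∎)
        where open ≡-Reasoning

      thirds-pos : ∀ {w} → 0 < thirds w → ∃[ s ] s < T × Spread u v s × w ≡ third u v s
      thirds-pos {w} pos with ∑-pos T _ pos
      ... | s , s<T , pos′ = s , s<T , 𝟙-witness (Spread? u v s ×-dec w ≟ third u v s) pos′

      thirds≤1 : ∀ w → thirds w ≤ 1
      thirds≤1 w = ∑-≤1 T _ (λ s _ → 𝟙≤1 (Spread? u v s ×-dec w ≟ third u v s)) same-sum
        where
        same-sum : ∀ s s′ → s < T → s′ < T → 0 < 𝟙 (Spread? u v s ×-dec w ≟ third u v s) →
                   0 < 𝟙 (Spread? u v s′ ×-dec w ≟ third u v s′) → s ≡ s′
        same-sum s s′ s<T s′<T pos pos′ = begin
          s                    ≡⟨ σ-third u v (s<N s<T) ⟨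
          σ u v (third u v s)  ≡⟨ cong (σ u v) (sym w≡t ⟨ trans ⟩ w≡t′) ⟩
          σ u v (third u v s′) ≡⟨ σ-third u v (s<N s′<T) ⟩
          s′                   ∎
          where
          open ≡-Reasoning
          w≡t  = proj₂ (𝟙-witness (Spread? u v s ×-dec w ≟ third u v s) pos)
          w≡t′ = proj₂ (𝟙-witness (Spread? u v s′ ×-dec w ≟ third u v s′) pos′)

      thirds-paired : ∀ {w} → SamePair w u ⊎ SamePair w v → thirds w ≡ 0
      thirds-paired {w} paired with 0 <? thirds w
      ... | no ¬pos = n≤0⇒n≡0 (≮⇒≥ ¬pos)
      ... | yes pos with thirds-pos {w} pos | paired
      ...   | _ , _ , (_ , t≁u , _) , w≡t | inj₁ w∼u = ⊥-elim (t≁u (trans (cong pair (sym w≡t)) w∼u))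
      ...   | _ , _ , (_ , _ , t≁v) , w≡t | inj₂ w∼v = ⊥-elim (t≁v (trans (cong pair (sym w≡t)) w∼v))

      through : ℕ → ℕ
      through w = 𝟙 (w ≟ partner u) + 𝟙 (w ≟ partner v) + thirds w

      through≤𝟙Edge : ∀ w → through w ≤ 𝟙 (Edge? u v w)
      through≤𝟙Edge w = ≤𝟙 (Edge? u v w)
        (𝟙+𝟙+≤1 (w ≟ partner u) (w ≟ partner v) (thirds≤1 w)
          (λ w≡pu w≡pv → v≁u (trans (sym (pair-partner v)) (trans (cong pair (sym w≡pv ⟨ trans ⟩ w≡pu)) (pair-partner u))))
          (λ w≡pu → thirds-paired {w} (inj₁ (cong pair w≡pu ⟨ trans ⟩ pair-partner u)))
          (λ w≡pv → thirds-paired {w} (inj₂ (cong pair w≡pv ⟨ trans ⟩ pair-partner v))))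
        (λ pos → edge (𝟙+𝟙+-pos (w ≟ partner u) (w ≟ partner v) pos))
        where
        edge : w ≡ partner u ⊎ w ≡ partner v ⊎ 0 < thirds w → Edge u v w
        edge (inj₁ w≡pu)        = subst (Edge u v) (sym w≡pu) edge-partner-u
        edge (inj₂ (inj₁ w≡pv)) = subst (Edge u v) (sym w≡pv) edge-partner-v
        edge (inj₂ (inj₂ pos)) with thirds-pos {w} pos
        ... | _ , s<T , spread , w≡t = subst (Edge u v) (sym w≡t) (edge-third s<T spread)

      ∑-through : ∑[ w < N ] through w ≡ 2 + ∑[ s < T ] 𝟙 (Spread? u v s)
      ∑-through = begin
        ∑[ w < N ] through w
          ≡⟨ ∑-distrib-+ N (λ w → 𝟙 (w ≟ partner u) + 𝟙 (w ≟ partner v)) thirds ⟩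
        ∑[ w < N ] (𝟙 (w ≟ partner u) + 𝟙 (w ≟ partner v)) + ∑[ w < N ] thirds w
          ≡⟨ cong₂ _+_ (∑-distrib-+ N (λ w → 𝟙 (w ≟ partner u)) (λ w → 𝟙 (w ≟ partner v))) ∑-thirds ⟩
        ∑[ w < N ] 𝟙 (w ≟ partner u) + ∑[ w < N ] 𝟙 (w ≟ partner v) + ∑[ s < T ] 𝟙 (Spread? u v s)
          ≡⟨ cong (_+ ∑[ s < T ] 𝟙 (Spread? u v s)) (cong₂ _+_ (∑-𝟙≡ N (partner<N u)) (∑-𝟙≡ N (partner<N v))) ⟩
        2 + ∑[ s < T ] 𝟙 (Spread? u v s)
          ∎
        where open ≡-Reasoning

      through-count : 2 + ∑[ s < T ] 𝟙 (Spread? u v s) ≤ ∑[ w < N ] 𝟙 (Edge? u v w)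
      through-count = subst (_≤ ∑[ w < N ] 𝟙 (Edge? u v w)) ∑-through (∑-mono-≤ N (λ w _ → through≤𝟙Edge w))

    partner-row-sum : ℕ
    partner-row-sum = ∑[ w < N ] 𝟙 (Edge? u (partner u) w)

    row-term : ∀ {v} → v < N →
               partner-row-sum * 𝟙 (v ≟ partner u) + 2 * 𝟙 (¬? (pair v ≟ pair u)) + ∑[ s < T ] 𝟙 (Spread? u v s)
               ≤ ∑[ w < N ] 𝟙 (Edge? u v w)
    row-term {v} v<N = by-cases (pair v ≟ pair u) (v ≟ partner u)
      where
      R = partner-row-sum
      lhs : ℕ → ℕ → ℕ → ℕ
      lhs x y z = R * x + 2 * y + z
      no-spread : SamePair v u → ∑[ s < T ] 𝟙 (Spread? u v s) ≡ 0
      no-spread v∼u = trans (∑-cong T λ s _ → 𝟙-no (Spread? u v s) (λ spread → proj₁ spread v∼u))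
                            (trans (∑-const T 0) (*-zeroʳ T))
      by-cases : Dec (SamePair v u) → Dec (v ≡ partner u) →
                 lhs (𝟙 (v ≟ partner u)) (𝟙 (¬? (pair v ≟ pair u))) (∑[ s < T ] 𝟙 (Spread? u v s))
                 ≤ ∑[ w < N ] 𝟙 (Edge? u v w)
      by-cases (no v≁u) _ = begin
        lhs (𝟙 (v ≟ partner u)) (𝟙 (¬? (pair v ≟ pair u))) (∑[ s < T ] 𝟙 (Spread? u v s))
          ≡⟨ cong₂ (λ x y → lhs x y (∑[ s < T ] 𝟙 (Spread? u v s)))
                   (𝟙-no (v ≟ partner u) (v≁u ∘ (_⟨ trans ⟩ pair-partner u) ∘ cong pair))
                   (𝟙-yes (¬? (pair v ≟ pair u)) v≁u) ⟩
        R * 0 + 2 + ∑[ s < T ] 𝟙 (Spread? u v s)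
          ≡⟨ cong (λ x → x + 2 + ∑[ s < T ] 𝟙 (Spread? u v s)) (*-zeroʳ R) ⟩
        2 + ∑[ s < T ] 𝟙 (Spread? u v s)        ≤⟨ Unpaired.through-count v<N v≁u ⟩
        ∑[ w < N ] 𝟙 (Edge? u v w)              ∎
        where open ≤-Reasoning
      by-cases (yes v∼u) (yes v≡pu) = begin
        lhs (𝟙 (v ≟ partner u)) (𝟙 (¬? (pair v ≟ pair u))) (∑[ s < T ] 𝟙 (Spread? u v s))
          ≡⟨ cong₂ (λ x y → lhs x y (∑[ s < T ] 𝟙 (Spread? u v s)))
                   (𝟙-yes (v ≟ partner u) v≡pu) (𝟙-no (¬? (pair v ≟ pair u)) (λ v≁u → v≁u v∼u)) ⟩
        R * 1 + 0 + ∑[ s < T ] 𝟙 (Spread? u v s)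
          ≡⟨ cong₂ _+_ (+-identityʳ (R * 1) ⟨ trans ⟩ *-identityʳ R) (no-spread v∼u) ⟩
        R + 0                                    ≡⟨ +-identityʳ R ⟩
        R                                        ≡⟨ cong (λ x → ∑[ w < N ] 𝟙 (Edge? u x w)) v≡pu ⟨
        ∑[ w < N ] 𝟙 (Edge? u v w)               ∎
        where open ≤-Reasoning
      by-cases (yes v∼u) (no v≢pu) = ≤-trans (≤-reflexive (begin
        lhs (𝟙 (v ≟ partner u)) (𝟙 (¬? (pair v ≟ pair u))) (∑[ s < T ] 𝟙 (Spread? u v s))
          ≡⟨ cong₂ (λ x y → lhs x y (∑[ s < T ] 𝟙 (Spread? u v s)))
                   (𝟙-no (v ≟ partner u) v≢pu) (𝟙-no (¬? (pair v ≟ pair u)) (λ v≁u → v≁u v∼u)) ⟩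
        R * 0 + 0 + ∑[ s < T ] 𝟙 (Spread? u v s) ≡⟨ cong₂ (λ x y → x + 0 + y) (*-zeroʳ R) (no-spread v∼u) ⟩
        0                                        ∎)) z≤n
        where open ≡-Reasoning

    row-bound : (3 + T) * N ≤ ∑[ v < N ] ∑[ w < N ] 𝟙 (Edge? u v w) + (6 + 8 * T)
    row-bound = combine {N} {R} {C} {G} {S} {T} partner-row unpaired-count spread-total row-sum
      where
      R C G S : ℕ
      R = partner-row-sum
      C = ∑[ v < N ] 𝟙 (¬? (pair v ≟ pair u))
      G = ∑[ s < T ] ∑[ v < N ] 𝟙 (Spread? u v s)
      S = ∑[ v < N ] ∑[ w < N ] 𝟙 (Edge? u v w)

      row-sum : R + 2 * C + G ≤ S
      row-sum = begin
        R + 2 * C + G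
          ≡⟨ cong₂ (λ x y → x + 2 * C + y) (trans (sym (*-identityʳ R)) (cong (R *_) (sym (∑-𝟙≡ N (partner<N u)))))
                                            (∑-comm T N _) ⟩
        R * ∑[ v < N ] 𝟙 (v ≟ partner u) + 2 * C + ∑[ v < N ] ∑[ s < T ] 𝟙 (Spread? u v s)
          ≡⟨ cong₂ (λ x y → x + y + ∑[ v < N ] ∑[ s < T ] 𝟙 (Spread? u v s))
                   (sym (∑-distribˡ-* N R _)) (sym (∑-distribˡ-* N 2 _)) ⟩
        ∑[ v < N ] (R * 𝟙 (v ≟ partner u)) + ∑[ v < N ] (2 * 𝟙 (¬? (pair v ≟ pair u)))
          + ∑[ v < N ] ∑[ s < T ] 𝟙 (Spread? u v s)
          ≡⟨ cong (_+ ∑[ v < N ] ∑[ s < T ] 𝟙 (Spread? u v s)) (sym (∑-distrib-+ N _ _)) ⟩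
        ∑[ v < N ] (R * 𝟙 (v ≟ partner u) + 2 * 𝟙 (¬? (pair v ≟ pair u)))
          + ∑[ v < N ] ∑[ s < T ] 𝟙 (Spread? u v s)
          ≡⟨ sym (∑-distrib-+ N _ _) ⟩
        ∑[ v < N ] (R * 𝟙 (v ≟ partner u) + 2 * 𝟙 (¬? (pair v ≟ pair u)) + ∑[ s < T ] 𝟙 (Spread? u v s))
          ≤⟨ ∑-mono-≤ N (λ _ → row-term) ⟩
        S ∎
        where open ≤-Reasoning

      spread-total : T * N ≤ G + 8 * T
      spread-total = begin
        T * N                                ≡⟨ ∑-const T N ⟨
        ∑[ _ < T ] N                         ≤⟨ ∑-mono-≤ T (λ _ → spread-count) ⟩
        ∑[ s < T ] (∑[ v < N ] 𝟙 (Spread? u v s) + 8) ≡⟨ ∑-distrib-+ T _ _ ⟩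
        G + ∑[ _ < T ] 8                     ≡⟨ cong (G +_) (trans (∑-const T 8) (*-comm T 8)) ⟩
        G + 8 * T                            ∎
        where open ≤-Reasoning

      combine : ∀ {N R C G S T} → N ≤ R + 2 → N ≤ C + 2 → T * N ≤ G + 8 * T → R + 2 * C + G ≤ S →
                (3 + T) * N ≤ S + (6 + 8 * T)
      combine {N} {R} {C} {G} {S} {T} h₁ h₂ h₃ h₄ = begin
        (3 + T) * N                       ≡⟨ e₁ N T ⟩
        N + 2 * N + T * N                 ≤⟨ +-mono-≤ (+-mono-≤ h₁ (*-monoʳ-≤ 2 h₂)) h₃ ⟩
        R + 2 + 2 * (C + 2) + (G + 8 * T) ≡⟨ e₂ R C G T ⟩
        R + 2 * C + G + (6 + 8 * T)       ≤⟨ +-monoˡ-≤ (6 + 8 * T) h₄ ⟩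
        S + (6 + 8 * T)                   ∎
        where
        open ≤-Reasoning
        e₁ : ∀ N T → (3 + T) * N ≡ N + 2 * N + T * N
        e₁ = solve-∀
        e₂ : ∀ R C G T → R + 2 + 2 * (C + 2) + (G + 8 * T) ≡ R + 2 * C + G + (6 + 8 * T)
        e₂ = solve-∀

  lower-bound : T ≤ N → ∀ n → N ≤ n → N * ((3 + T) * N) ≤ 6 * ∣ OnVertices.hypergraphOf n ∣ₑ + N * (6 + 8 * T)
  lower-bound T≤N n N≤n = begin
    N * ((3 + T) * N)                                                   ≡⟨ ∑-const N ((3 + T) * N) ⟨
    ∑[ _ < N ] ((3 + T) * N)                                            ≤⟨ ∑-mono-≤ N (λ _ → LowerBound.row-bound T≤N) ⟩
    ∑[ u < N ] (∑[ v < N ] ∑[ w < N ] 𝟙 (Edge? u v w) + (6 + 8 * T))    ≡⟨ ∑-distrib-+ N _ _ ⟩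
    ∑[ u < N ] ∑[ v < N ] ∑[ w < N ] 𝟙 (Edge? u v w) + ∑[ _ < N ] (6 + 8 * T)
      ≡⟨ cong (∑[ u < N ] ∑[ v < N ] ∑[ w < N ] 𝟙 (Edge? u v w) +_) (∑-const N (6 + 8 * T)) ⟩
    ∑[ u < N ] ∑[ v < N ] ∑[ w < N ] 𝟙 (Edge? u v w) + N * (6 + 8 * T)
      ≤⟨ +-monoˡ-≤ (N * (6 + 8 * T)) (widen λ u → widen λ v → widen λ w → ≤-refl) ⟩
    ∑[ u < n ] ∑[ v < n ] ∑[ w < n ] 𝟙 (Edge? u v w) + N * (6 + 8 * T) ≡⟨ cong (_+ N * (6 + 8 * T)) (sym size-hyperedges) ⟩
    6 * ∣ hypergraphOf ∣ₑ + N * (6 + 8 * T)                              ∎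
    where
    open ≤-Reasoning
    open OnVertices n
    widen : ∀ {f g} → (∀ i → f i ≤ g i) → ∑ N f ≤ ∑ n g
    widen {f} {g} f≤g = ≤-trans (∑-mono-≤ N (λ i _ → f≤g i)) (∑-monoˡ-≤ g N≤n)

-- Asymptotics of ex₃

ex₃-upper : ∀ T {n m} → IsEx₃ n (3 + T) S₂ m → 6 * m ≤ (3 + T) * n ^ 2
ex₃-upper T {n} ((H , S₂-free , |H|≡m) , _) = subst (λ x → 6 * x ≤ (3 + T) * n ^ 2) |H|≡m (upper-bound H S₂-free)

square-between : ∀ t {N n A} → N ≤ n → n ≤ suc N → 1 ≤ n → N * (t * N) ≤ A + N * (8 * t) →
                 t * n ^ 2 ≤ A + 11 * t * n
square-between t {N} {n} {A} N≤n n≤1+N 1≤n h = begin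
  t * n ^ 2                                        ≤⟨ *-monoʳ-≤ t (*-mono-≤ n≤1+N (*-monoˡ-≤ 1 n≤1+N)) ⟩
  t * (suc N * (suc N * 1))                        ≡⟨ e₁ t N ⟩
  N * (t * N) + (2 * t * N + t)                    ≤⟨ +-monoˡ-≤ _ h ⟩
  A + N * (8 * t) + (2 * t * N + t)                ≤⟨ +-mono-≤ (+-monoʳ-≤ A (*-monoˡ-≤ (8 * t) N≤n))
                                                               (+-mono-≤ (*-monoʳ-≤ (2 * t) N≤n) t≤t*n) ⟩
  A + n * (8 * t) + (2 * t * n + t * n)            ≡⟨ e₂ t n A ⟩
  A + 11 * t * n                                   ∎
  where
  open ≤-Reasoning
  e₁ : ∀ t N → t * (suc N * (suc N * 1)) ≡ N * (t * N) + (2 * t * N + t)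
  e₁ = solve-∀
  e₂ : ∀ t n A → A + n * (8 * t) + (2 * t * n + t * n) ≡ A + 11 * t * n
  e₂ = solve-∀
  t≤t*n : t ≤ t * n
  t≤t*n = ≤-trans (≤-reflexive (sym (*-identityʳ t))) (*-monoʳ-≤ t 1≤n)

ex₃-lower : ∀ T {n m} → 2 + T ≤ n → IsEx₃ n (3 + T) S₂ m → (3 + T) * n ^ 2 ≤ 6 * m + 11 * (3 + T) * n
ex₃-lower T {suc (suc n′)} {m} (s≤s (s≤s T≤n′)) (_ , maximal) =
  square-between (3 + T) N≤n n≤1+N (s≤s z≤n) (begin
    N * ((3 + T) * N)                                    ≤⟨ lower-bound T≤N n N≤n ⟩
    6 * ∣ OnVertices.hypergraphOf n ∣ₑ + N * (6 + 8 * T) ≤⟨ +-mono-≤ (*-monoʳ-≤ 6 size≤m) (*-monoʳ-≤ N 6+8T≤8t) ⟩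
    6 * m + N * (8 * (3 + T))                            ∎)
  where
  n = suc (suc n′)
  open Construction (n′ / 2) T
  open ≤-Reasoning
  n≡N+r : n ≡ N + n′ % 2
  n≡N+r = trans (cong (2 +_) (m≡m%n+[m/n]*n n′ 2)) (rearrange (n′ / 2) (n′ % 2))
    where
    rearrange : ∀ h r → 2 + (r + h * 2) ≡ 2 * suc h + r
    rearrange = solve-∀
  N≤n : N ≤ n
  N≤n = subst (N ≤_) (sym n≡N+r) (m≤m+n N (n′ % 2))
  n≤1+N : n ≤ suc N
  n≤1+N = subst (_≤ suc N) (sym n≡N+r) (subst (N + n′ % 2 ≤_) (+-comm N 1) (+-monoʳ-≤ N (≤-pred (m%n<n n′ 2))))
  T≤N : T ≤ N
  T≤N = ≤-trans T≤n′ (≤-trans (n≤1+n n′) (≤-pred n≤1+N))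
  size≤m : ∣ OnVertices.hypergraphOf n ∣ₑ ≤ m
  size≤m = maximal (OnVertices.hypergraphOf n) (S₂-free n)
  6+8T≤8t : 6 + 8 * T ≤ 8 * (3 + T)
  6+8T≤8t = subst (6 + 8 * T ≤_) (sym (*-distribˡ-+ 8 3 T)) (+-monoˡ-≤ (8 * T) (m≤m+n 6 18))

proposition11 : (t : ℕ) → 3 ≤ t → (k : ℕ) →
    Σ ℕ λ N → (n : ℕ) → N ≤ n → (m : ℕ) → IsEx₃ n t S₂ m →
    (suc k * (6 * m ∸ t * n ^ 2) ≤ n ^ 2) × (suc k * (t * n ^ 2 ∸ 6 * m) ≤ n ^ 2)
proposition11 zero                () _
proposition11 (suc zero)          (s≤s ()) _
proposition11 (suc (suc zero))    (s≤s (s≤s ())) _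
proposition11 t@(suc (suc (suc T))) _ k = suc k * (11 * t) , bounds
  where
  bounds : (n : ℕ) → suc k * (11 * t) ≤ n → (m : ℕ) → IsEx₃ n t S₂ m →
           (suc k * (6 * m ∸ t * n ^ 2) ≤ n ^ 2) × (suc k * (t * n ^ 2 ∸ 6 * m) ≤ n ^ 2)
  bounds n N≤n m ex = excess , deficit
    where
    open ≤-Reasoning
    2+T≤n : 2 + T ≤ n
    2+T≤n = ≤-trans (n≤1+n (2 + T)) (≤-trans (m≤n*m t 11) (≤-trans (m≤n*m (11 * t) (suc k)) N≤n))
    excess : suc k * (6 * m ∸ t * n ^ 2) ≤ n ^ 2
    excess = begin
      suc k * (6 * m ∸ t * n ^ 2) ≡⟨ cong (suc k *_) (m≤n⇒m∸n≡0 (ex₃-upper T ex)) ⟩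
      suc k * 0                   ≡⟨ *-zeroʳ (suc k) ⟩
      0                           ≤⟨ z≤n ⟩
      n ^ 2                       ∎
    deficit : suc k * (t * n ^ 2 ∸ 6 * m) ≤ n ^ 2
    deficit = begin
      suc k * (t * n ^ 2 ∸ 6 * m) ≤⟨ *-monoʳ-≤ (suc k) (m≤n+o⇒m∸n≤o (t * n ^ 2) (6 * m) (ex₃-lower T 2+T≤n ex)) ⟩
      suc k * (11 * t * n)        ≡⟨ *-assoc (suc k) (11 * t) n ⟨
      suc k * (11 * t) * n        ≤⟨ *-monoˡ-≤ n N≤n ⟩
      n * n                       ≡⟨ cong (n *_) (*-identityʳ n) ⟨
      n ^ 2                       ∎
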